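{- Let $s\ge1$, $t\ge0$, let $\boldsymbol{x}_0,\boldsymbol{x}_1,\ldots$ be the points of an order 2 digital $(t,s)$-sequence over $\mathbb{F}_2$, let $N\ge 2$ with $N=2^{m_1}+\cdots+2^{m_r}$, $m_1>\cdots>m_r\ge0$, let $\boldsymbol{b}\in\mathbb{N}_0^s$ and $\boldsymbol{\ell}\in B(\boldsymbol{b})$. Then, with $c(\boldsymbol{\ell})$ as in the context, $$|c(\boldsymbol{\ell})|\le C\,\frac1N\sum_{h=1}^r2^{m_h-|\boldsymbol{b}|_1-2(m_h-|\boldsymbol{b}|_1)_+}\binom{2(m_h-|\boldsymbol{b}|_1)_++s-1}{s-1},$$ where $(v)_+=\max\{0,v\}$ and $C>0$ depends only on $s$ and $t$.
   Context: Order 2 digital $(t,s)$-sequence over $\mathbb{F}_2$: digital sequence with generating matrices $C_j=(c_{j,k,\ell})\in\mathbb{F}_2^{\mathbb{N}\times\mathbb{N}}$, $c_{j,k,\ell}=0$ for $k>2\ell$ (points $\boldsymbol{x}_n=(x_{1,n},\ldots,x_{s,n})$, $x_{j,n}=\sum_{k\ge1}(\sum_{\ell\ge1}n_{\ell-1}c_{j,k,\ell}\bmod2)2^{ -k}$ for $n=\sum_in_i2^i$), such that for all $m>t/2$ the upper-left submatrices $C_j^{2m\times m}$, with rows $c_{j,1},\ldots,c_{j,2m}$, satisfy: for all $\nu_j\ge0$ and $1\le i_{j,\nu_j}<\cdots<i_{j,1}\le2m$ with $\sum_j\sum_{l=1}^{\min(\nu_j,2)}i_{j,l}\le2m-t$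 the rows $c_{j,i_{j,l}}$ are linearly independent. Walsh functions: $\mathrm{wal}_k(x)=(-1)^{\sum_{i\ge0}\kappa_ix_{i+1}}$ for $k=\sum\kappa_i2^i$, $x=\sum_{i\ge1}x_i2^{ -i}$; $\mathrm{wal}_{\boldsymbol{k}}(\boldsymbol{x})=\prod_j\mathrm{wal}_{k_j}(x_j)$. $\mu_1(0)=0$, $\mu_1(k)=1+\lfloor\log_2k\rfloor$, $\mu_1(\boldsymbol{\ell})=\sum_j\mu_1(\ell_j)$, $\nu(\boldsymbol{\ell})=(\mu_1(\ell_j))_j$, $B(\boldsymbol{b})=\{\boldsymbol{\ell}\in\mathbb{N}_0^s:\mu_1(\ell_j)=b_j\ \forall j\}$, $|\boldsymbol{b}|_1=\sum_jb_j$. $\oplus$: digitwise addition mod 2 of nonnegative integers; $\boldsymbol{\ell}\oplus\lfloor2^{\boldsymbol{w}+\nu(\boldsymbol{\ell})-\boldsymbol{1}}\rfloor$ has $j$th entry $\ell_j\oplus\lfloor2^{w_j+\mu_1(\ell_j)-1}\rfloor$. For $u\subseteq\{1,\ldots,s\}$, $\boldsymbol{z}_u\in\mathbb{N}^{|u|}$, $(\boldsymbol{z}_u,\boldsymbol{0})\in\mathbb{N}_0^s$ has entries $z_j$ ($j\in u$), $0$ otherwise. Coefficient: $c(\boldsymbol{\ell})=\sum_{u\in A(\boldsymbol{\ell})}(-1)^{s-|u|}\sum_{\boldsymbol{z}_u\in\mathbb{N}^{|u|}}2^{ -\mu_1(\boldsymbol{\ell})-|\boldsymbol{z}_u|_1-s}\frac1N\sum_{n=0}^{N-1}\mathrm{wal}_{\boldsymbol{\ell}\oplus\lfloor2^{(\boldsymbol{z}_u,\boldsymbol{0})+\nu(\boldsymbol{\ell})-\boldsymbol{1}}\rfloor}(\boldsymbol{x}_n)$,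 where $A(\boldsymbol{\ell})$ is the set of all subsets of $\{1,\ldots,s\}$ except that $\emptyset$ is excluded when every $\ell_j$ is $0$ or a power of $2$. -}

module Defs where

open import Data.Bool using (Bool; true; false; _∧_; _∨_; not; if_then_else_; T)
open import Data.Bool.Base using (_xor_)
open import Data.Nat as ℕ using (ℕ; zero; suc; _+_; _*_; _∸_; _^_; _≤_; _<_; _/_; _%_)
open import Data.Nat.Properties using (m^n≢0)
open import Data.Nat.Logarithm using (⌊log₂_⌋)
open import Data.Nat.Combinatorics using (_C_)
open import Data.Integer as ℤ using (ℤ; +_; -[1+_])
open import Data.Rational as ℚ using (ℚ; 0ℚ; 1ℚ; ½)
open import Data.Fin using (Fin; zero; suc; toℕ)
open import Data.List using (List; []; _∷_; _++_; map; foldr; take; upTo; applyDownFrom; filter; length; allFin; concatMap; zipWith)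
open import Data.Nat.ListAction using (sum)
open import Data.Bool.ListAction using (and; or)
open import Data.List.Relation.Unary.All using (All)
open import Data.Vec as Vec using (Vec)
open import Data.List.Relation.Unary.Any using (Any)
open import Relation.Binary.PropositionalEquality using (_≡_; _≢_)
open import Relation.Nullary using (¬_)
open import Relation.Nullary.Decidable using (does)
open import Data.Product using (Σ; _×_; _,_)

bit : ℕ → ℕ → Bool
bit n i = does (((n / 2 ^ i) {{m^n≢0 2 i}}) % 2 ℕ.≟ 1)

-- digitwise addition mod 2 (with fuel; fuel a + b suffices)
xorF : ℕ → ℕ → ℕ → ℕ
xorF zero    a b = 0
xorF (suc f) a b = (if (bit a 0 xor bit b 0) then 1 else 0) + 2 * xorF f (a / 2) (b / 2)

_⊕_ : ℕ → ℕ → ℕ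
a ⊕ b = xorF (a + b) a b

μ₁ : ℕ → ℕ
μ₁ zero    = 0
μ₁ (suc k) = suc ⌊log₂ (suc k) ⌋

-- ⌊2^(e-1)⌋ for e : ℕ  (equals 0 when e = 0)
floor2^pred : ℕ → ℕ
floor2^pred zero    = 0
floor2^pred (suc e) = 2 ^ e

zeroOrPow2F : ℕ → ℕ → Bool
zeroOrPow2F f             zero          = true
zeroOrPow2F f             (suc zero)    = true
zeroOrPow2F zero          (suc (suc n)) = false
zeroOrPow2F (suc f) (suc (suc n)) =
  if bit (suc (suc n)) 0 then false else zeroOrPow2F f (suc (suc n) / 2)

zeroOrPow2 : ℕ → Bool
zeroOrPow2 n = zeroOrPow2F n n

sumℚ : List ℕ → (ℕ → ℚ) → ℚ
sumℚ xs f = foldr (λ x acc → f x ℚ.+ acc) 0ℚ xs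

inv2^ : ℕ → ℚ
inv2^ zero    = 1ℚ
inv2^ (suc k) = ½ ℚ.* inv2^ k

pow2ℤ : ℤ → ℚ
pow2ℤ (+ n)      = (+ (2 ^ n)) ℚ./ 1
pow2ℤ -[1+ n ]   = inv2^ (suc n)

-- z / N ; defined as 0 for N = 0 (never used with N = 0)
divN : ℤ → ℕ → ℚ
divN z zero    = 0ℚ
divN z (suc n) = z ℚ./ suc n

-- Digital sequences over F₂
-- A generating-matrix family: Cm j k ℓ = c_{j,k,ℓ}, indices k, ℓ ≥ 1
-- (the values at index 0 are irrelevant and never used).

GenMatrices : ℕ → Set
GenMatrices s = Fin s → ℕ → ℕ → Bool

parity : List Bool → Bool
parity = foldr _xor_ false

oneTo : ℕ → List ℕ
oneTo n = map suc (upTo n)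

-- k-th binary digit (k ≥ 1) of x_{j,n} = Σ_ℓ n_{ℓ-1} c_{j,k,ℓ} mod 2.
-- Only ℓ ≤ n+1 can contribute, since n_{ℓ-1} = 0 for ℓ - 1 ≥ n.
digit : ∀ {s} → GenMatrices s → Fin s → ℕ → ℕ → Bool
digit Cm j n k = parity (map (λ ℓ → bit n (ℓ ∸ 1) ∧ Cm j k ℓ) (oneTo (suc n)))

-- wal_k(x) = (-1)^{Σ_{i≥0} κ_i x_{i+1}}, with κ_i = 0 for i ≥ k
-- value as a sign: true means -1.
walSign : (ℕ → Bool) → ℕ → Bool
walSign x k = parity (map (λ i → bit k i ∧ x (suc i)) (upTo k))

walVec : ∀ {s} → GenMatrices s → (Fin s → ℕ) → ℕ → ℤ
walVec {s} Cm k n =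
  if parity (map (λ j → walSign (digit Cm j n) (k j)) (allFin s)) then ℤ.-[1+ 0 ] else + 1

walAvg : ∀ {s} → GenMatrices s → ℕ → (Fin s → ℕ) → ℚ
walAvg Cm N k = divN (foldr (λ n acc → walVec Cm k n ℤ.+ acc) (+ 0) (upTo N)) N

selDesc : ℕ → (ℕ → Bool) → List ℕ
selDesc M S = filter (λ i → S i ≟B true) (applyDownFrom suc M)
  where open import Data.Bool.Properties using () renaming (_≟_ to _≟B_)

topTwo : List ℕ → ℕ
topTwo is = sum (take 2 is)

-- A vector of F₂^m is given by its entries at positions 1,...,m
-- (an ℕ → Bool function, only positions 1..m are looked at).
lincomb : List Bool → List (ℕ → Bool) → ℕ → Bool
lincomb cs vs ℓ = parity (zipWith (λ c v → c ∧ v ℓ) cs vs)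

LinIndep : ℕ → List (ℕ → Bool) → Set
LinIndep m vs =
  (cs : Vec Bool (length vs)) → T (or (Vec.toList cs)) →
  ¬ All (λ ℓ → lincomb (Vec.toList cs) vs ℓ ≡ false) (oneTo m)

Order2 : ∀ {s} → GenMatrices s → Set
Order2 Cm = ∀ j k ℓ → 1 ≤ ℓ → 2 * ℓ < k → Cm j k ℓ ≡ false

TSCondition : ∀ {s} → ℕ → GenMatrices s → Set
TSCondition {s} t Cm =
  ∀ (m : ℕ) → t < 2 * m → ∀ (I : Fin s → ℕ → Bool) →
  sum (map (λ j → topTwo (selDesc (2 * m) (I j))) (allFin s)) ≤ 2 * m ∸ t →
  LinIndep m (concatMap (λ j → map (λ i ℓ → Cm j i ℓ) (selDesc (2 * m) (I j))) (allFin s))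

IsOrder2DigitalTS : (t s : ℕ) → GenMatrices s → Set
IsOrder2DigitalTS t s Cm = Order2 Cm × TSCondition t Cm

-- The coefficient c(ℓ), truncated: z_u ranges over {1,...,Z}^{|u|}

allSubsets : (s : ℕ) → List (Fin s → Bool)
allSubsets zero    = (λ ()) ∷ []
allSubsets (suc s) =
  concatMap (λ u → (λ { zero → false ; (suc j) → u j }) ∷ (λ { zero → true ; (suc j) → u j }) ∷ [])
            (allSubsets s)

card : ∀ {s} → (Fin s → Bool) → ℕ
card {s} u = length (filter (λ j → u j ≟B true) (allFin s))
  where open import Data.Bool.Properties using () renaming (_≟_ to _≟B_)

box : (s : ℕ) → (Fin s → Bool) → ℕ → List (Fin s → ℕ)
box zero    u Z = (λ ()) ∷ []
box (suc s) u Z =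
  concatMap (λ z₀ → map (λ g → λ { zero → z₀ ; (suc j) → g j }) (box s (λ j → u (suc j)) Z))
            (if u zero then oneTo Z else 0 ∷ [])

sumFin : ∀ {s} → (Fin s → ℕ) → ℕ
sumFin {s} f = sum (map f (allFin s))

inA : ∀ {s} → (Fin s → ℕ) → (Fin s → Bool) → Bool
inA {s} ℓ u = or (map u (allFin s)) ∨ not (and (map (λ j → zeroOrPow2 (ℓ j)) (allFin s)))

sign : ℕ → ℚ
sign e = if bit e 0 then ℚ.- 1ℚ else 1ℚ

cTrunc : ∀ {s} → GenMatrices s → (N : ℕ) → (Fin s → ℕ) → (Z : ℕ) → ℚ
cTrunc {s} Cm N ℓ Z =
  sumℚ' (allSubsets s) λ u →
    if inA ℓ u
    then sign (s ∸ card u) ℚ.*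
         sumℚ' (box s u Z) (λ z →
           inv2^ (sumFin (λ j → μ₁ (ℓ j)) + sumFin z + s) ℚ.*
           walAvg Cm N (λ j → ℓ j ⊕ floor2^pred (z j + μ₁ (ℓ j))))
    else 0ℚ
  where
  sumℚ' : ∀ {A : Set} → List A → (A → ℚ) → ℚ
  sumℚ' xs f = foldr (λ x acc → f x ℚ.+ acc) 0ℚ xs

-- The bound  (1/N) Σ_h 2^{m_h - |b|₁ - 2(m_h - |b|₁)_+} binom(2(m_h - |b|₁)_+ + s - 1, s - 1)
-- ((v)_+ = max(0,v) = m_h ∸ |b|₁ here)

boundSum : (s N : ℕ) → (b : Fin s → ℕ) → List ℕ → ℚ
boundSum s N b ms =
  divN (+ 1) N ℚ.*
  sumℚ ms (λ mh →
    pow2ℤ ((+ mh) ℤ.- (+ sumFin b) ℤ.- (+ 2) ℤ.* (+ (mh ∸ sumFin b))) ℚ.*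
    ((+ ((2 * (mh ∸ sumFin b) + s ∸ 1) C (s ∸ 1))) ℚ./ 1))

{-# OPTIONS --safe #-}
-- For a digital sequence, x_{2^a + n} is the digitwise sum of x_{2^a} and x_n whenever n < 2^a, so
-- n ↦ wal_k(x_n) is multiplicative along binary expansions. Hence the Walsh sum over the first 2^m
-- points is 2^m if wal_k(x_{2^a}) = 1 for all a < m and 0 otherwise, and the sum over the first
-- N = 2^{m_1} + ⋯ + 2^{m_r} points is at most the sum of these block values. The condition
-- wal_k(x_{2^a}) = 1 for all a < m says that the rows of the C_j selected by the digits of k add up
-- to zero in the first m columns. For k = ℓ ⊕ ⌊2^{z+ν(ℓ)-1}⌋ these rows have weight at most
-- |z| + 2|b|, so the (t, s)-condition rules this out unless 2m ≤ |z| + 2|b| + t. What remains of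
-- c(ℓ) is, for each h, 2^{m_h - |b|} times the 2^{-|z|}-mass of the z with |z| ≥ 2m_h - 2|b| - t,
-- a geometric tail that the hockey-stick identity bounds by the binomial coefficient.
module Submission where

open import Defs
open import Algebra using (CommutativeRing)
import Algebra.Properties.CommutativeSemigroup
open import Data.Bool using (Bool; true; false; _∧_; if_then_else_; T)
open import Data.Bool.Base using (_xor_)
import Data.Bool.Properties as Bool
open import Data.Bool.ListAction using (and; or)
open import Data.Nat using (ℕ; zero; suc; z≤n; s≤s; _+_; _*_; _∸_; _^_; _≤_; _<_; _>_; _/_; _%_; ⌊_/2⌋; _≤?_; _<?_; >-nonZero)
open import Data.Nat.Properties
open import Data.Nat.DivMod
open import Data.Nat.Divisibility using (divides)
open import Data.Nat.Induction using (<-wellFounded)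
open import Data.Nat.ListAction using (sum)
open import Data.Nat.Logarithm.Core using (⌊log2⌋)
open import Data.Nat.Combinatorics using (_C_; nCk+nC[k+1]≡[n+1]C[k+1]; nCn≡1)
import Data.Nat.Solver as ℕ-Solver
open import Data.Integer as ℤ using (ℤ; -[1+_]) renaming (+_ to pos; ∣_∣ to ∣_∣ℤ)
import Data.Integer.Properties as ℤ
import Data.Integer.Solver as ℤ-Solver
open import Data.Rational as ℚ using (ℚ; 0ℚ; 1ℚ; ½; ∣_∣)
import Data.Rational.Properties as ℚ
import Data.Rational.Solver as ℚ-Solver
open import Data.Rational.Unnormalised as ℚᵘ using (mkℚᵘ; *≡*)
import Data.Rational.Unnormalised.Properties as ℚᵘ
import Data.Fin as Fin
open Fin using (Fin)
open import Data.List using (List; []; _∷_; _++_; map; foldr; upTo; applyUpTo; applyDownFrom; allFin; filter; concatMap; length; take)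
import Data.List.Properties as List
open import Data.List.Relation.Unary.All as All using (All; []; _∷_)
import Data.List.Relation.Unary.All.Properties as All
open import Data.List.Relation.Unary.Any as Any using (Any; here; there)
open import Data.List.Relation.Unary.Linked as Linked using (Linked; _∷_)
open import Data.List.Membership.Propositional using (_∈_)
open import Data.List.Membership.Propositional.Properties using (∈-allFin; ∈-concatMap⁺; ∈-map⁺; ∈-filter⁺; ∈-applyDownFrom⁺)
open import Data.List.Membership.Setoid.Properties using (∈-length)
open import Data.Vec as Vec using (Vec)
open import Data.Unit using (tt)
open import Data.Empty using (⊥-elim)
open import Data.Sum using (_⊎_; inj₁; inj₂)
open import Data.Product using (Σ; _×_; _,_; proj₁; proj₂; ∃)
open import Function using (_∘_; id)
open import Induction.WellFounded using (Acc; acc)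
open import Relation.Binary.PropositionalEquality
open import Relation.Nullary using (¬_; does; yes; no; contradiction)
open import Relation.Nullary.Decidable using (dec-true; dec-false)

private
  variable
    A A′ : Set

-- Binary digits

bit-suc : ∀ n i → bit n (suc i) ≡ bit (n / 2) i
bit-suc n i = cong (λ x → does (x % 2 ≟ 1))
  (sym (m/n/o≡m/[n*o] n 2 (2 ^ i) {{_}} {{m^n≢0 2 i}} {{m^n≢0 2 (suc i)}}))

bit-<2^ : ∀ {n} i → n < 2 ^ i → bit n i ≡ false
bit-<2^ i n<2^i = cong (λ x → does (x % 2 ≟ 1)) (m<n⇒m/n≡0 {{m^n≢0 2 i}} n<2^i)

n<2^n : ∀ n → n < 2 ^ n
n<2^n zero    = s≤s z≤n
n<2^n (suc n) = +-mono-≤-< (m^n>0 2 n) (subst (n <_) (sym (+-identityʳ (2 ^ n))) (n<2^n n))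

bit-≥ : ∀ {n} i → n ≤ i → bit n i ≡ false
bit-≥ {n} i n≤i = bit-<2^ i (<-≤-trans (n<2^n n) (^-monoʳ-≤ 2 n≤i))

bit-[c+2x]-zero : ∀ {c} x → c < 2 → bit (c + 2 * x) 0 ≡ does (c ≟ 1)
bit-[c+2x]-zero {c} x c<2 = cong (λ y → does (y ≟ 1)) (begin
  (c + 2 * x) / 1 % 2 ≡⟨ cong (_% 2) (n/1≡n (c + 2 * x)) ⟩
  (c + 2 * x) % 2     ≡⟨ cong (λ y → (c + y) % 2) (*-comm 2 x) ⟩
  (c + x * 2) % 2     ≡⟨ [m+kn]%n≡m%n c x 2 ⟩
  c % 2               ≡⟨ m<n⇒m%n≡m c<2 ⟩
  c                   ∎)
  where open ≡-Reasoning

bit-[c+2x]-suc : ∀ {c} x i → c < 2 → bit (c + 2 * x) (suc i) ≡ bit x i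
bit-[c+2x]-suc {c} x i c<2 = trans (bit-suc _ i) (cong (λ y → bit y i) (begin
  (c + 2 * x) / 2   ≡⟨ +-distrib-/-∣ʳ c (divides x (*-comm 2 x)) ⟩
  c / 2 + 2 * x / 2 ≡⟨ cong₂ _+_ (m<n⇒m/n≡0 c<2) (trans (cong (_/ 2) (*-comm 2 x)) (m*n/n≡m x 2)) ⟩
  x                 ∎))
  where open ≡-Reasoning

bit-0 : ∀ i → bit 0 i ≡ false
bit-0 i = bit-<2^ i (m^n>0 2 i)

bit-2^ : ∀ a i → bit (2 ^ a) i ≡ does (a ≟ i)
bit-2^ zero    zero    = refl
bit-2^ zero    (suc i) = trans (bit-[c+2x]-suc 0 i (s≤s (s≤s z≤n))) (bit-0 i)
bit-2^ (suc a) zero    = bit-[c+2x]-zero (2 ^ a) (s≤s z≤n)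
bit-2^ (suc a) (suc i) = trans (bit-[c+2x]-suc (2 ^ a) i (s≤s z≤n)) (bit-2^ a i)

n≡n%2+2*[n/2] : ∀ n → n ≡ n % 2 + 2 * (n / 2)
n≡n%2+2*[n/2] n = trans (m≡m%n+[m/n]*n n 2) (cong (n % 2 +_) (*-comm (n / 2) 2))

bit-2^+ : ∀ m {n} i → n < 2 ^ m → bit (2 ^ m + n) i ≡ bit (2 ^ m) i xor bit n i
bit-2^+ zero    {zero}  i _ = sym (trans (cong (bit 1 i xor_) (bit-0 i)) (Bool.xor-identityʳ _))
bit-2^+ zero    {suc n} i (s≤s ())
bit-2^+ (suc m) {n}    i n<2^[1+m] =
  subst (λ y → bit (2 ^ suc m + y) i ≡ bit (2 ^ suc m) i xor bit y i) (sym (n≡n%2+2*[n/2] n)) (digits i)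
  where
  c = n % 2
  x = n / 2
  c<2 = m%n<n n 2
  regroup : 2 * 2 ^ m + (c + 2 * x) ≡ c + 2 * (2 ^ m + x)
  regroup = solve 3 (λ p c x → con 2 :* p :+ (c :+ con 2 :* x) := c :+ con 2 :* (p :+ x)) refl (2 ^ m) c x
    where open ℕ-Solver.+-*-Solver
  digits : ∀ i → bit (2 * 2 ^ m + (c + 2 * x)) i ≡ bit (2 * 2 ^ m) i xor bit (c + 2 * x) i
  digits zero = begin
    bit (2 * 2 ^ m + (c + 2 * x)) 0             ≡⟨ cong (λ y → bit y 0) regroup ⟩
    bit (c + 2 * (2 ^ m + x)) 0                 ≡⟨ bit-[c+2x]-zero (2 ^ m + x) c<2 ⟩
    does (c ≟ 1)                                ≡⟨ sym (cong₂ _xor_ (bit-[c+2x]-zero (2 ^ m) (s≤s z≤n)) (bit-[c+2x]-zero x c<2)) ⟩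
    bit (2 * 2 ^ m) 0 xor bit (c + 2 * x) 0     ∎
    where open ≡-Reasoning
  digits (suc i) = begin
    bit (2 * 2 ^ m + (c + 2 * x)) (suc i)           ≡⟨ cong (λ y → bit y (suc i)) regroup ⟩
    bit (c + 2 * (2 ^ m + x)) (suc i)               ≡⟨ bit-[c+2x]-suc (2 ^ m + x) i c<2 ⟩
    bit (2 ^ m + x) i                               ≡⟨ bit-2^+ m i x<2^m ⟩
    bit (2 ^ m) i xor bit x i                       ≡⟨ sym (cong₂ _xor_ (bit-[c+2x]-suc (2 ^ m) i (s≤s z≤n)) (bit-[c+2x]-suc x i c<2)) ⟩
    bit (2 * 2 ^ m) (suc i) xor bit (c + 2 * x) (suc i) ∎
    where
    open ≡-Reasoning
    x<2^m : x < 2 ^ m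
    x<2^m = m<n*o⇒m/o<n (subst (n <_) (*-comm 2 (2 ^ m)) n<2^[1+m])

2*m≤1+n⇒m≤n : ∀ {m n} → 2 * m ≤ suc n → m ≤ n
2*m≤1+n⇒m≤n {zero}      _ = z≤n
2*m≤1+n⇒m≤n {suc m} {n} h = ≤-pred (≤-trans (s≤s (s≤s (m≤m+n m (m + 0)))) (subst (_≤ suc n) (cong suc (+-suc m (m + 0))) h))

2*[m/2+n/2]≤m+n : ∀ m n → 2 * (m / 2 + n / 2) ≤ m + n
2*[m/2+n/2]≤m+n m n = begin
  2 * (m / 2 + n / 2)         ≡⟨ *-distribˡ-+ 2 (m / 2) (n / 2) ⟩
  2 * (m / 2) + 2 * (n / 2)   ≤⟨ +-mono-≤ (half m) (half n) ⟩
  m + n                       ∎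
  where
  open ≤-Reasoning
  half : ∀ k → 2 * (k / 2) ≤ k
  half k = subst (_≤ k) (*-comm (k / 2) 2) (m/n*n≤m k 2)

if1else0<2 : ∀ x → (if x then 1 else 0) < 2
if1else0<2 true  = s≤s (s≤s z≤n)
if1else0<2 false = s≤s z≤n

bit-xorF : ∀ f a b i → a + b ≤ f → bit (xorF f a b) i ≡ bit a i xor bit b i
bit-xorF zero    zero    zero    i _  = trans (bit-0 i) (sym (cong₂ _xor_ (bit-0 i) (bit-0 i)))
bit-xorF (suc f) a       b       zero    _   =
  trans (bit-[c+2x]-zero (xorF f (a / 2) (b / 2)) (if1else0<2 (bit a 0 xor bit b 0))) (does-if (bit a 0 xor bit b 0))
  where
  does-if : ∀ x → does ((if x then 1 else 0) ≟ 1) ≡ x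
  does-if true  = refl
  does-if false = refl
bit-xorF (suc f) a       b       (suc i) a+b≤1+f = begin
  bit (xorF (suc f) a b) (suc i)          ≡⟨ bit-[c+2x]-suc (xorF f (a / 2) (b / 2)) i (if1else0<2 (bit a 0 xor bit b 0)) ⟩
  bit (xorF f (a / 2) (b / 2)) i          ≡⟨ bit-xorF f (a / 2) (b / 2) i (2*m≤1+n⇒m≤n (≤-trans (2*[m/2+n/2]≤m+n a b) a+b≤1+f)) ⟩
  bit (a / 2) i xor bit (b / 2) i         ≡⟨ sym (cong₂ _xor_ (bit-suc a i) (bit-suc b i)) ⟩
  bit a (suc i) xor bit b (suc i)         ∎
  where open ≡-Reasoning

bit-⊕ : ∀ a b i → bit (a ⊕ b) i ≡ bit a i xor bit b i
bit-⊕ a b i = bit-xorF (a + b) a b i ≤-refl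

n≤1+2*⌊n/2⌋ : ∀ n → n ≤ suc (2 * ⌊ n /2⌋)
n≤1+2*⌊n/2⌋ zero          = z≤n
n≤1+2*⌊n/2⌋ (suc zero)    = s≤s z≤n
n≤1+2*⌊n/2⌋ (suc (suc n)) = s≤s (s≤s (≤-trans (n≤1+2*⌊n/2⌋ n) (≤-reflexive (sym (+-suc ⌊ n /2⌋ (⌊ n /2⌋ + 0))))))

n<2^[1+⌊log2⌋n] : ∀ n (rec : Acc _<_ n) → n < 2 ^ suc (⌊log2⌋ n rec)
n<2^[1+⌊log2⌋n] zero          _         = s≤s z≤n
n<2^[1+⌊log2⌋n] (suc zero)    _         = s≤s (s≤s z≤n)
n<2^[1+⌊log2⌋n] (suc (suc n)) (acc rec) = double (n<2^[1+⌊log2⌋n] (suc ⌊ n /2⌋) (rec (⌊n/2⌋<n (suc n))))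
  where
  double : ∀ {p} → suc (suc ⌊ n /2⌋) ≤ p → suc (suc (suc n)) ≤ 2 * p
  double {p} h = begin
    suc (suc (suc n))                   ≤⟨ s≤s (s≤s (s≤s (n≤1+2*⌊n/2⌋ n))) ⟩
    suc (suc (suc (suc (2 * ⌊ n /2⌋)))) ≡⟨ sym (*-distribˡ-+ 2 2 ⌊ n /2⌋) ⟩
    2 * suc (suc ⌊ n /2⌋)               ≤⟨ *-monoʳ-≤ 2 h ⟩
    2 * p                               ∎
    where open ≤-Reasoning

n<2^μ₁n : ∀ n → n < 2 ^ μ₁ n
n<2^μ₁n zero    = s≤s z≤n
n<2^μ₁n (suc n) = n<2^[1+⌊log2⌋n] (suc n) _

bit-≥μ₁ : ∀ n {i} → μ₁ n ≤ i → bit n i ≡ false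
bit-≥μ₁ n {i} μ₁n≤i = bit-<2^ i (<-≤-trans (n<2^μ₁n n) (^-monoʳ-≤ 2 μ₁n≤i))

bit⇒<μ₁ : ∀ n {i} → bit n i ≡ true → i < μ₁ n
bit⇒<μ₁ n {i} set with i <? μ₁ n
... | yes i<μ₁n = i<μ₁n
... | no  i≮μ₁n with () ← trans (sym set) (bit-≥μ₁ n (≮⇒≥ i≮μ₁n))

bit-floor2^pred : ∀ e {i} → bit (floor2^pred e) i ≡ true → suc i ≡ e
bit-floor2^pred zero    {i} set with () ← trans (sym set) (bit-0 i)
bit-floor2^pred (suc e) {i} set with e ≟ i
... | yes refl = refl
... | no  e≢i  with () ← trans (sym set) (trans (bit-2^ e i) (dec-false (e ≟ i) e≢i))

bit0≡false⇒even : ∀ n → bit n 0 ≡ false → n ≡ 2 * (n / 2)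
bit0≡false⇒even n unset with n % 2 | m%n<n n 2 | n≡n%2+2*[n/2] n
... | zero       | _               | n≡2*[n/2] = n≡2*[n/2]
... | suc zero   | _               | n≡1+2*[n/2]
  with () ← trans (sym unset) (trans (cong (λ y → bit y 0) n≡1+2*[n/2]) (bit-[c+2x]-zero (n / 2) (s≤s (s≤s z≤n))))
... | suc (suc _) | s≤s (s≤s ())  | _

positive⇒bit : ∀ n → 0 < n → ∃ λ i → bit n i ≡ true
positive⇒bit n = go n (<-wellFounded n)
  where
  go : ∀ n → Acc _<_ n → 0 < n → ∃ λ i → bit n i ≡ true
  go n (acc rec) 0<n with bit n 0 in set
  ... | true  = 0 , set
  ... | false = suc (proj₁ rest) , trans (bit-suc n (proj₁ rest)) (proj₂ rest)
    where
    instance _ = >-nonZero 0<n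
    0<n/2 : 0 < n / 2
    0<n/2 = n≢0⇒n>0 (λ n/2≡0 → <-irrefl (sym (trans (bit0≡false⇒even n set) (cong (2 *_) n/2≡0))) 0<n)
    rest = go (n / 2) (rec (m/n<m n 2 (s≤s (s≤s z≤n)))) 0<n/2

single-bit⇒zeroOrPow2F : ∀ f n c → n ≤ f → (∀ i → bit n i ≡ true → i ≡ c) → zeroOrPow2F f n ≡ true
single-bit⇒zeroOrPow2F f       zero          c _   _      = refl
single-bit⇒zeroOrPow2F f       (suc zero)    c _   _      = refl
single-bit⇒zeroOrPow2F (suc f) n@(suc (suc _)) c n≤1+f single with bit n 0 in set
... | true  = let i , set′ = positive⇒bit (n / 2) (m≥n⇒m/n>0 {n} (s≤s (s≤s z≤n)))
              in ⊥-elim (0≢1+n (trans (single 0 set) (sym (single (suc i) (trans (bit-suc n i) set′)))))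
... | false = single-bit⇒zeroOrPow2F f (n / 2) (c ∸ 1) (≤-pred (<-≤-trans (m/n<m n 2 (s≤s (s≤s z≤n))) n≤1+f))
                (λ i set′ → cong (_∸ 1) (single (suc i) (trans (bit-suc n i) set′)))

bit-⊕floor2^pred : ∀ ℓ e {i} → bit (ℓ ⊕ floor2^pred e) i ≡ true → i < μ₁ ℓ ⊎ suc i ≡ e
bit-⊕floor2^pred ℓ e {i} set with bit ℓ i in setℓ | bit (floor2^pred e) i in sete | bit-⊕ ℓ (floor2^pred e) i
... | true  | _     | _ = inj₁ (bit⇒<μ₁ ℓ setℓ)
... | false | true  | _ = inj₂ (bit-floor2^pred e sete)
... | false | false | unset with () ← trans (sym set) unset

bit-⊕floor2^pred-top : ∀ ℓ e → μ₁ ℓ ≤ e → bit (ℓ ⊕ floor2^pred (suc e)) e ≡ true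
bit-⊕floor2^pred-top ℓ e μ₁ℓ≤e = begin
  bit (ℓ ⊕ (2 ^ e)) e       ≡⟨ bit-⊕ ℓ (2 ^ e) e ⟩
  bit ℓ e xor bit (2 ^ e) e ≡⟨ cong₂ _xor_ (bit-≥μ₁ ℓ μ₁ℓ≤e) (trans (bit-2^ e e) (dec-true (e ≟ e) refl)) ⟩
  true                      ∎
  where open ≡-Reasoning

¬zeroOrPow2⇒bit-⊕floor2^pred : ∀ ℓ → zeroOrPow2 ℓ ≡ false → ∃ λ i → bit (ℓ ⊕ floor2^pred (μ₁ ℓ)) i ≡ true
¬zeroOrPow2⇒bit-⊕floor2^pred ℓ notPow2 with anyUpTo? (λ i → bit (ℓ ⊕ floor2^pred (μ₁ ℓ)) i Bool.≟ true) (μ₁ ℓ)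
... | yes (i , _ , set) = i , set
... | no  none = contradiction (trans (sym (single-bit⇒zeroOrPow2F ℓ ℓ (μ₁ ℓ ∸ 1) ≤-refl onlyTop)) notPow2) λ ()
  where
  onlyTop : ∀ i → bit ℓ i ≡ true → i ≡ μ₁ ℓ ∸ 1
  onlyTop i setℓ with bit (floor2^pred (μ₁ ℓ)) i in settop | bit-⊕ ℓ (floor2^pred (μ₁ ℓ)) i
  ... | true  | _     = cong (_∸ 1) (bit-floor2^pred (μ₁ ℓ) settop)
  ... | false | ⊕bit  = ⊥-elim (none (i , bit⇒<μ₁ ℓ setℓ , trans ⊕bit (cong (_xor false) setℓ)))

-- Parities of Boolean lists

parity-++ : ∀ xs ys → parity (xs ++ ys) ≡ parity xs xor parity ys
parity-++ []       ys = refl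
parity-++ (x ∷ xs) ys = trans (cong (x xor_) (parity-++ xs ys)) (sym (Bool.xor-assoc x (parity xs) (parity ys)))

parity-∷ʳ : ∀ xs x → parity (xs ++ x ∷ []) ≡ parity xs xor x
parity-∷ʳ xs x = trans (parity-++ xs (x ∷ [])) (cong (parity xs xor_) (Bool.xor-identityʳ x))

parity-false : ∀ {bs} → All (_≡ false) bs → parity bs ≡ false
parity-false []         = refl
parity-false (b≡f ∷ bs) = cong₂ _xor_ b≡f (parity-false bs)

parity-map-false : ∀ (f : A → Bool) xs → (∀ x → f x ≡ false) → parity (map f xs) ≡ false
parity-map-false f xs f≗false = parity-false {map f xs} (All.map⁺ (All.tabulate λ {x} _ → f≗false x))

parity-map-xor : ∀ (f g : A → Bool) xs → parity (map (λ x → f x xor g x) xs) ≡ parity (map f xs) xor parity (map g xs)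
parity-map-xor f g []       = refl
parity-map-xor f g (x ∷ xs) =
  trans (cong ((f x xor g x) xor_) (parity-map-xor f g xs)) (interchange (f x) (g x) (parity (map f xs)) (parity (map g xs)))
  where open Algebra.Properties.CommutativeSemigroup (CommutativeRing.+-commutativeSemigroup Bool.xor-∧-commutativeRing)

parity-concatMap : ∀ (g : A′ → Bool) (F : A → List A′) xs →
  parity (map g (concatMap F xs)) ≡ parity (map (λ x → parity (map g (F x))) xs)
parity-concatMap g F []       = refl
parity-concatMap g F (x ∷ xs) = begin
  parity (map g (F x ++ concatMap F xs))                 ≡⟨ cong parity (List.map-++ g (F x) (concatMap F xs)) ⟩
  parity (map g (F x) ++ map g (concatMap F xs))         ≡⟨ parity-++ (map g (F x)) (map g (concatMap F xs)) ⟩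
  parity (map g (F x)) xor parity (map g (concatMap F xs)) ≡⟨ cong (parity (map g (F x)) xor_) (parity-concatMap g F xs) ⟩
  parity (map (λ x → parity (map g (F x))) (x ∷ xs))     ∎
  where open ≡-Reasoning

parity-filter : ∀ (S f : ℕ → Bool) xs →
  parity (map f (filter (λ i → S i Bool.≟ true) xs)) ≡ parity (map (λ i → S i ∧ f i) xs)
parity-filter S f []       = refl
parity-filter S f (x ∷ xs) with S x
... | true  = cong (f x xor_) (parity-filter S f xs)
... | false = parity-filter S f xs

parity-applyDownFrom : ∀ (g : ℕ → A) (f : A → Bool) n →
  parity (map f (applyDownFrom g n)) ≡ parity (map f (applyUpTo g n))
parity-applyDownFrom g f zero    = refl
parity-applyDownFrom g f (suc n) = begin
  f (g n) xor parity (map f (applyDownFrom g n))     ≡⟨ cong (f (g n) xor_) (parity-applyDownFrom g f n) ⟩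
  f (g n) xor parity (map f (applyUpTo g n))         ≡⟨ Bool.xor-comm (f (g n)) _ ⟩
  parity (map f (applyUpTo g n)) xor f (g n)         ≡⟨ sym (parity-∷ʳ (map f (applyUpTo g n)) (f (g n))) ⟩
  parity (map f (applyUpTo g n) ++ f (g n) ∷ [])     ≡⟨ cong parity (sym (List.map-++ f (applyUpTo g n) (g n ∷ []))) ⟩
  parity (map f (applyUpTo g n ++ g n ∷ []))         ≡⟨ cong (parity ∘ map f) (List.applyUpTo-∷ʳ g n) ⟩
  parity (map f (applyUpTo g (suc n)))               ∎
  where open ≡-Reasoning

applyUpTo-cong : ∀ {f g : ℕ → A} → (∀ i → f i ≡ g i) → ∀ n → applyUpTo f n ≡ applyUpTo g n
applyUpTo-cong f≗g zero    = refl
applyUpTo-cong f≗g (suc n) = cong₂ _∷_ (f≗g 0) (applyUpTo-cong (f≗g ∘ suc) n)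

applyUpTo-+ : ∀ (f : ℕ → A) m n → applyUpTo f (m + n) ≡ applyUpTo f m ++ applyUpTo (λ i → f (m + i)) n
applyUpTo-+ f zero    n = refl
applyUpTo-+ f (suc m) n = cong (f 0 ∷_) (applyUpTo-+ (f ∘ suc) m n)

parity-applyUpTo-≥ : ∀ (h : ℕ → Bool) {a n} → a ≤ n → (∀ {i} → a ≤ i → h i ≡ false) →
  parity (applyUpTo h n) ≡ parity (applyUpTo h a)
parity-applyUpTo-≥ h {a} {n} a≤n beyond = begin
  parity (applyUpTo h n)                                   ≡⟨ cong (parity ∘ applyUpTo h) (sym (m+[n∸m]≡n a≤n)) ⟩
  parity (applyUpTo h (a + (n ∸ a)))                       ≡⟨ cong parity (applyUpTo-+ h a (n ∸ a)) ⟩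
  parity (applyUpTo h a ++ applyUpTo (λ i → h (a + i)) (n ∸ a)) ≡⟨ parity-++ (applyUpTo h a) _ ⟩
  parity (applyUpTo h a) xor parity (applyUpTo (λ i → h (a + i)) (n ∸ a))
    ≡⟨ cong (parity (applyUpTo h a) xor_) (parity-false (All.applyUpTo⁺₂ _ (n ∸ a) (λ i → beyond (m≤m+n a i)))) ⟩
  parity (applyUpTo h a) xor false                         ≡⟨ Bool.xor-identityʳ _ ⟩
  parity (applyUpTo h a)                                   ∎
  where open ≡-Reasoning

parity-applyUpTo-single : ∀ (h : ℕ → Bool) {a n} → a < n → (∀ {i} → i ≢ a → h i ≡ false) →
  parity (applyUpTo h n) ≡ h a
parity-applyUpTo-single h {a} {n} a<n elsewhere = begin
  parity (applyUpTo h n)                ≡⟨ parity-applyUpTo-≥ h a<n (λ a<i → elsewhere (λ i≡a → <-irrefl (sym i≡a) a<i)) ⟩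
  parity (applyUpTo h (suc a))          ≡⟨ cong parity (sym (List.applyUpTo-∷ʳ h a)) ⟩
  parity (applyUpTo h a ++ h a ∷ [])    ≡⟨ parity-∷ʳ (applyUpTo h a) (h a) ⟩
  parity (applyUpTo h a) xor h a        ≡⟨ cong (_xor h a) (parity-false (All.applyUpTo⁺₁ h a (λ i<a → elsewhere (λ i≡a → <-irrefl i≡a i<a)))) ⟩
  h a                                   ∎
  where open ≡-Reasoning

-- Digits of the points and Walsh sums

module _ {s} (Cm : GenMatrices s) (j : Fin s) (k : ℕ) where

  digit-applyUpTo : ∀ n {R} → n < R → digit Cm j n k ≡ parity (applyUpTo (λ i → bit n i ∧ Cm j k (suc i)) R)
  digit-applyUpTo n {R} n<R = begin
    parity (map (λ ℓ → bit n (ℓ ∸ 1) ∧ Cm j k ℓ) (map suc (upTo (suc n))))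
      ≡⟨ cong parity (trans (sym (List.map-∘ {g = λ ℓ → bit n (ℓ ∸ 1) ∧ Cm j k ℓ} {f = suc} (upTo (suc n))))
                            (List.map-applyUpTo id (λ i → bit n i ∧ Cm j k (suc i)) (suc n))) ⟩
    parity (applyUpTo (λ i → bit n i ∧ Cm j k (suc i)) (suc n))
      ≡⟨ sym (parity-applyUpTo-≥ (λ i → bit n i ∧ Cm j k (suc i)) n<R (λ {i} n<i → cong (_∧ Cm j k (suc i)) (bit-≥ i (<⇒≤ n<i)))) ⟩
    parity (applyUpTo (λ i → bit n i ∧ Cm j k (suc i)) R) ∎
    where open ≡-Reasoning

  digit-2^+ : ∀ m {n} → n < 2 ^ m → digit Cm j (2 ^ m + n) k ≡ digit Cm j (2 ^ m) k xor digit Cm j n k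
  digit-2^+ m {n} n<2^m = begin
    digit Cm j (2 ^ m + n) k
      ≡⟨ digit-applyUpTo (2 ^ m + n) ≤-refl ⟩
    parity (applyUpTo (λ i → bit (2 ^ m + n) i ∧ Cm j k (suc i)) R)
      ≡⟨ cong parity (applyUpTo-cong (λ i → trans (cong (_∧ Cm j k (suc i)) (bit-2^+ m i n<2^m)) (Bool.∧-distribʳ-xor (Cm j k (suc i)) (bit (2 ^ m) i) (bit n i))) R) ⟩
    parity (applyUpTo (λ i → term (2 ^ m) i xor term n i) R)
      ≡⟨ cong parity (sym (List.map-applyUpTo id (λ i → term (2 ^ m) i xor term n i) R)) ⟩
    parity (map (λ i → term (2 ^ m) i xor term n i) (upTo R))
      ≡⟨ parity-map-xor (term (2 ^ m)) (term n) (upTo R) ⟩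
    parity (map (term (2 ^ m)) (upTo R)) xor parity (map (term n) (upTo R))
      ≡⟨ cong₂ _xor_ (cong parity (List.map-applyUpTo id (term (2 ^ m)) R)) (cong parity (List.map-applyUpTo id (term n) R)) ⟩
    parity (applyUpTo (term (2 ^ m)) R) xor parity (applyUpTo (term n) R)
      ≡⟨ sym (cong₂ _xor_ (digit-applyUpTo (2 ^ m) (s≤s (m≤m+n (2 ^ m) n))) (digit-applyUpTo n (s≤s (m≤n+m n (2 ^ m))))) ⟩
    digit Cm j (2 ^ m) k xor digit Cm j n k ∎
    where
    open ≡-Reasoning
    R = suc (2 ^ m + n)
    term : ℕ → ℕ → Bool
    term x i = bit x i ∧ Cm j k (suc i)

  digit-2^ : ∀ a → digit Cm j (2 ^ a) k ≡ Cm j k (suc a)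
  digit-2^ a = begin
    digit Cm j (2 ^ a) k                                        ≡⟨ digit-applyUpTo (2 ^ a) ≤-refl ⟩
    parity (applyUpTo (λ i → bit (2 ^ a) i ∧ Cm j k (suc i)) (suc (2 ^ a)))
      ≡⟨ parity-applyUpTo-single (λ i → bit (2 ^ a) i ∧ Cm j k (suc i)) (s≤s (<⇒≤ (n<2^n a)))
           (λ {i} i≢a → cong (_∧ Cm j k (suc i)) (trans (bit-2^ a i) (dec-false (a ≟ i) (i≢a ∘ sym)))) ⟩
    bit (2 ^ a) a ∧ Cm j k (suc a)                              ≡⟨ cong (_∧ Cm j k (suc a)) (trans (bit-2^ a a) (dec-true (a ≟ a) refl)) ⟩
    Cm j k (suc a)                                              ∎
    where open ≡-Reasoning

walSign-cong : ∀ {x y : ℕ → Bool} → (∀ i → x i ≡ y i) → ∀ k → walSign x k ≡ walSign y k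
walSign-cong x≗y k = cong parity (List.map-cong (λ i → cong (bit k i ∧_) (x≗y (suc i))) (upTo k))

walSign-xor : ∀ (x y : ℕ → Bool) k → walSign (λ i → x i xor y i) k ≡ walSign x k xor walSign y k
walSign-xor x y k = trans (cong parity (List.map-cong (λ i → Bool.∧-distribˡ-xor (bit k i) (x (suc i)) (y (suc i))) (upTo k)))
  (parity-map-xor (λ i → bit k i ∧ x (suc i)) (λ i → bit k i ∧ y (suc i)) (upTo k))

sum-2^-<2^head : ∀ m ms → Linked _>_ (m ∷ ms) → sum (map (2 ^_) ms) < 2 ^ m
sum-2^-<2^head m []        _             = m^n>0 2 m
sum-2^-<2^head m (m′ ∷ ms) (m>m′ ∷ rest) = begin-strict
  2 ^ m′ + sum (map (2 ^_) ms) <⟨ +-monoʳ-< (2 ^ m′) (sum-2^-<2^head m′ ms rest) ⟩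
  2 ^ m′ + 2 ^ m′              ≡⟨ cong (2 ^ m′ +_) (sym (+-identityʳ (2 ^ m′))) ⟩
  2 ^ suc m′                   ≤⟨ ^-monoʳ-≤ 2 m>m′ ⟩
  2 ^ m                        ∎
  where open ≤-Reasoning

2*n>0⇒n>0 : ∀ {n} → 0 < 2 * n → 0 < n
2*n>0⇒n>0 {suc _} _ = s≤s z≤n

signℤ : Bool → ℤ
signℤ b = if b then -[1+ 0 ] else pos 1

signℤ-xor : ∀ a b → signℤ (a xor b) ≡ signℤ a ℤ.* signℤ b
signℤ-xor true  true  = refl
signℤ-xor true  false = refl
signℤ-xor false b     = sym (ℤ.*-identityˡ (signℤ b))

∣signℤ∣ : ∀ a → ℤ.∣ signℤ a ∣ ≡ 1
∣signℤ∣ true  = refl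
∣signℤ∣ false = refl

module _ {s} (Cm : GenMatrices s) (k : Fin s → ℕ) where

  walParity : ℕ → Bool
  walParity n = parity (map (λ j → walSign (digit Cm j n) (k j)) (allFin s))

  walParity-2^+ : ∀ m {n} → n < 2 ^ m → walParity (2 ^ m + n) ≡ walParity (2 ^ m) xor walParity n
  walParity-2^+ m {n} n<2^m = trans
    (cong parity (List.map-cong (λ j → trans (walSign-cong (λ i → digit-2^+ Cm j i m n<2^m) (k j))
                                             (walSign-xor (digit Cm j (2 ^ m)) (digit Cm j n) (k j))) (allFin s)))
    (parity-map-xor (λ j → walSign (digit Cm j (2 ^ m)) (k j)) (λ j → walSign (digit Cm j n) (k j)) (allFin s))

  walParity-0 : walParity 0 ≡ false
  walParity-0 = parity-map-false _ (allFin s) λ j → parity-map-false _ (upTo (k j)) λ i → Bool.∧-zeroʳ (bit (k j) i)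

  walVec-2^+ : ∀ m {n} → n < 2 ^ m → walVec Cm k (2 ^ m + n) ≡ walVec Cm k (2 ^ m) ℤ.* walVec Cm k n
  walVec-2^+ m {n} n<2^m = trans (cong signℤ (walParity-2^+ m n<2^m)) (signℤ-xor (walParity (2 ^ m)) (walParity n))

  walSum : List ℕ → ℤ
  walSum = foldr (λ n acc → walVec Cm k n ℤ.+ acc) (pos 0)

  walSum-++ : ∀ xs ys → walSum (xs ++ ys) ≡ walSum xs ℤ.+ walSum ys
  walSum-++ []       ys = sym (ℤ.+-identityˡ _)
  walSum-++ (x ∷ xs) ys = trans (cong (λ y → walVec Cm k x ℤ.+ y) (walSum-++ xs ys)) (sym (ℤ.+-assoc (walVec Cm k x) _ _))

  walSum-shift : ∀ m {xs} → All (_< 2 ^ m) xs → walSum (map (2 ^ m +_) xs) ≡ walVec Cm k (2 ^ m) ℤ.* walSum xs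
  walSum-shift m {[]}     []           = sym (ℤ.*-zeroʳ (walVec Cm k (2 ^ m)))
  walSum-shift m {x ∷ xs} (x< ∷ xs<) = trans (cong₂ ℤ._+_ (walVec-2^+ m x<) (walSum-shift m xs<))
    (sym (ℤ.*-distribˡ-+ (walVec Cm k (2 ^ m)) (walVec Cm k x) (walSum xs)))

  walSum-upTo-2^+ : ∀ m {n} → n ≤ 2 ^ m →
    walSum (upTo (2 ^ m + n)) ≡ walSum (upTo (2 ^ m)) ℤ.+ walVec Cm k (2 ^ m) ℤ.* walSum (upTo n)
  walSum-upTo-2^+ m {n} n≤2^m = begin
    walSum (upTo (2 ^ m + n))                                    ≡⟨ cong walSum (applyUpTo-+ id (2 ^ m) n) ⟩
    walSum (upTo (2 ^ m) ++ applyUpTo (2 ^ m +_) n)              ≡⟨ walSum-++ (upTo (2 ^ m)) _ ⟩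
    walSum (upTo (2 ^ m)) ℤ.+ walSum (applyUpTo (2 ^ m +_) n)    ≡⟨ cong (λ xs → walSum (upTo (2 ^ m)) ℤ.+ walSum xs) (sym (List.map-applyUpTo id (2 ^ m +_) n)) ⟩
    walSum (upTo (2 ^ m)) ℤ.+ walSum (map (2 ^ m +_) (upTo n))
      ≡⟨ cong (λ y → walSum (upTo (2 ^ m)) ℤ.+ y) (walSum-shift m (All.map (λ i<n → <-≤-trans i<n n≤2^m) (All.all-upTo n))) ⟩
    walSum (upTo (2 ^ m)) ℤ.+ walVec Cm k (2 ^ m) ℤ.* walSum (upTo n) ∎
    where open ≡-Reasoning

  dyadicWalSum : ℕ → ℕ
  dyadicWalSum zero    = 1
  dyadicWalSum (suc m) = if walParity (2 ^ m) then 0 else 2 * dyadicWalSum m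

  walSum-upTo-2^ : ∀ m → walSum (upTo (2 ^ m)) ≡ pos (dyadicWalSum m)
  walSum-upTo-2^ zero    = cong (λ b → signℤ b ℤ.+ pos 0) walParity-0
  walSum-upTo-2^ (suc m) = begin
    walSum (upTo (2 ^ m + (2 ^ m + 0)))                                 ≡⟨ cong (λ n → walSum (upTo (2 ^ m + n))) (+-identityʳ (2 ^ m)) ⟩
    walSum (upTo (2 ^ m + 2 ^ m))                                       ≡⟨ walSum-upTo-2^+ m ≤-refl ⟩
    walSum (upTo (2 ^ m)) ℤ.+ walVec Cm k (2 ^ m) ℤ.* walSum (upTo (2 ^ m)) ≡⟨ cong (λ x → x ℤ.+ walVec Cm k (2 ^ m) ℤ.* x) (walSum-upTo-2^ m) ⟩
    pos D ℤ.+ signℤ (walParity (2 ^ m)) ℤ.* pos D                           ≡⟨ doubleOrCancel (walParity (2 ^ m)) ⟩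
    pos (if walParity (2 ^ m) then 0 else 2 * D)                          ∎
    where
    open ≡-Reasoning
    D = dyadicWalSum m
    doubleOrCancel : ∀ b → pos D ℤ.+ signℤ b ℤ.* pos D ≡ pos (if b then 0 else 2 * D)
    doubleOrCancel true  = trans (cong (λ y → pos D ℤ.+ y) (ℤ.-1*i≡-i (pos D))) (ℤ.+-inverseʳ (pos D))
    doubleOrCancel false = trans (cong (λ y → pos D ℤ.+ y) (ℤ.*-identityˡ (pos D))) (cong (λ y → pos (D + y)) (sym (+-identityʳ D)))

  dyadicWalSum≤2^ : ∀ m → dyadicWalSum m ≤ 2 ^ m
  dyadicWalSum≤2^ zero    = ≤-refl
  dyadicWalSum≤2^ (suc m) with walParity (2 ^ m)
  ... | true  = z≤n
  ... | false = *-monoʳ-≤ 2 (dyadicWalSum≤2^ m)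

  dyadicWalSum>0⇒walParity-2^ : ∀ m → 0 < dyadicWalSum m → ∀ {a} → a < m → walParity (2 ^ a) ≡ false
  dyadicWalSum>0⇒walParity-2^ (suc m) D>0 {a} a<1+m with walParity (2 ^ m) in even
  ... | true  = contradiction D>0 (<-irrefl refl)
  ... | false with m≤n⇒m<n∨m≡n (≤-pred a<1+m)
  ...   | inj₁ a<m  = dyadicWalSum>0⇒walParity-2^ m (2*n>0⇒n>0 D>0) a<m
  ...   | inj₂ refl = even

  ∣walSum∣≤ : ∀ ms → Linked _>_ ms → ∣ walSum (upTo (sum (map (2 ^_) ms))) ∣ℤ ≤ sum (map dyadicWalSum ms)
  ∣walSum∣≤ []       _      = z≤n
  ∣walSum∣≤ (m ∷ ms) sorted = begin
    ∣ walSum (upTo (2 ^ m + N′)) ∣ℤ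
      ≡⟨ cong ℤ.∣_∣ (walSum-upTo-2^+ m (<⇒≤ (sum-2^-<2^head m ms sorted))) ⟩
    ∣ walSum (upTo (2 ^ m)) ℤ.+ walVec Cm k (2 ^ m) ℤ.* walSum (upTo N′) ∣ℤ
      ≤⟨ ℤ.∣i+j∣≤∣i∣+∣j∣ (walSum (upTo (2 ^ m))) _ ⟩
    ∣ walSum (upTo (2 ^ m)) ∣ℤ + ∣ walVec Cm k (2 ^ m) ℤ.* walSum (upTo N′) ∣ℤ
      ≡⟨ cong₂ _+_ (cong ℤ.∣_∣ (walSum-upTo-2^ m))
                   (trans (ℤ.∣i*j∣≡∣i∣*∣j∣ (walVec Cm k (2 ^ m)) _) (cong (_* ∣ walSum (upTo N′) ∣ℤ) (∣signℤ∣ (walParity (2 ^ m))))) ⟩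
    dyadicWalSum m + 1 * ∣ walSum (upTo N′) ∣ℤ
      ≤⟨ +-monoʳ-≤ (dyadicWalSum m) (≤-trans (≤-reflexive (*-identityˡ _)) (∣walSum∣≤ ms (Linked.tail sorted))) ⟩
    dyadicWalSum m + sum (map dyadicWalSum ms) ∎
    where
    open ≤-Reasoning
    N′ = sum (map (2 ^_) ms)

-- The (t, s)-condition and the weight of the Walsh index

-- The row selection I_j of TSCondition for the Walsh index k: row i of C_j is chosen iff digit i - 1 of k_j is 1.
digitRows : ∀ {s} → (Fin s → ℕ) → Fin s → ℕ → Bool
digitRows k j i = bit (k j) (i ∸ 1)

module _ {s} (Cm : GenMatrices s) (k : Fin s → ℕ) where

  rowsOf : ℕ → Fin s → List (ℕ → Bool)
  rowsOf m j = map (λ i ℓ → Cm j i ℓ) (selDesc (2 * m) (digitRows k j))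

  columnParity : Fin s → ℕ → Bool
  columnParity j c = parity (map (λ i → bit (k j) i ∧ Cm j (suc i) c) (upTo (k j)))

  walParity-2^-columns : ∀ a → walParity Cm k (2 ^ a) ≡ parity (map (λ j → columnParity j (suc a)) (allFin s))
  walParity-2^-columns a = cong parity (List.map-cong (λ j → walSign-cong (λ r → digit-2^ Cm j r a) (k j)) (allFin s))

  parity-rowsOf : Order2 Cm → ∀ m {c} → 1 ≤ c → c ≤ m → ∀ j →
    parity (map (λ v → v c) (rowsOf m j)) ≡ columnParity j c
  parity-rowsOf order2 m {c} 1≤c c≤m j = begin
    parity (map (λ v → v c) (rowsOf m j))
      ≡⟨ cong parity (sym (List.map-∘ (selDesc (2 * m) (digitRows k j)))) ⟩
    parity (map (λ i → Cm j i c) (selDesc (2 * m) (digitRows k j)))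
      ≡⟨ parity-filter (digitRows k j) (λ i → Cm j i c) (applyDownFrom suc (2 * m)) ⟩
    parity (map (λ i → digitRows k j i ∧ Cm j i c) (applyDownFrom suc (2 * m)))
      ≡⟨ parity-applyDownFrom suc _ (2 * m) ⟩
    parity (map (λ i → digitRows k j i ∧ Cm j i c) (applyUpTo suc (2 * m)))
      ≡⟨ cong parity (List.map-applyUpTo suc _ (2 * m)) ⟩
    parity (applyUpTo h (2 * m))
      ≡⟨ sym (parity-applyUpTo-≥ h (m≤n+m (2 * m) (k j)) beyondOrder2) ⟩
    parity (applyUpTo h (k j + 2 * m))
      ≡⟨ parity-applyUpTo-≥ h (m≤m+n (k j) (2 * m)) (λ {i} k≤i → cong (_∧ Cm j (suc i) c) (bit-≥ i k≤i)) ⟩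
    parity (applyUpTo h (k j))
      ≡⟨ cong parity (sym (List.map-applyUpTo id h (k j))) ⟩
    columnParity j c ∎
    where
    open ≡-Reasoning
    h : ℕ → Bool
    h i = bit (k j) i ∧ Cm j (suc i) c
    beyondOrder2 : ∀ {i} → 2 * m ≤ i → h i ≡ false
    beyondOrder2 {i} 2m≤i = trans (cong (bit (k j) i ∧_) (order2 j (suc i) c 1≤c (s≤s (≤-trans (*-monoʳ-≤ 2 c≤m) 2m≤i))))
                                 (Bool.∧-zeroʳ (bit (k j) i))

  lincomb-all : ∀ (vs : List (ℕ → Bool)) c → lincomb (Vec.toList (Vec.replicate (length vs) true)) vs c ≡ parity (map (λ v → v c) vs)
  lincomb-all []       c = refl
  lincomb-all (v ∷ vs) c = cong (v c xor_) (lincomb-all vs c)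

  -- The sum of all chosen rows vanishes on the first m columns, contradicting the (t, s)-condition.
  smallWeight⇒dyadicWalSum≡0 : ∀ {t} → IsOrder2DigitalTS t s Cm → ∀ m → t < 2 * m →
    (∃ λ j → ∃ λ e → e < 2 * m × bit (k j) e ≡ true) →
    sum (map (λ j → topTwo (selDesc (2 * m) (digitRows k j))) (allFin s)) ≤ 2 * m ∸ t →
    dyadicWalSum Cm k m ≡ 0
  smallWeight⇒dyadicWalSum≡0 (order2 , tsCondition) m t<2m (j , e , e<2m , set) weight with dyadicWalSum Cm k m in D
  ... | zero  = refl
  ... | suc _ = ⊥-elim (tsCondition m t<2m (digitRows k) weight (Vec.replicate (length rows) true) (or-replicate rowsNonEmpty) columnsVanish)
    where
    rows = concatMap (rowsOf m) (allFin s)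
    or-replicate : ∀ {n} → 0 < n → T (or (Vec.toList (Vec.replicate n true)))
    or-replicate {suc _} _ = tt
    rowsNonEmpty : 0 < length rows
    rowsNonEmpty = ∈-length (setoid _) (∈-concatMap⁺ (rowsOf m) (Any.map (λ { refl → row∈rowsOf }) (∈-allFin j)))
      where
      row∈rowsOf : (λ ℓ → Cm j (suc e) ℓ) ∈ rowsOf m j
      row∈rowsOf = ∈-map⁺ (λ i ℓ → Cm j i ℓ) (∈-filter⁺ (λ i → digitRows k j i Bool.≟ true) (∈-applyDownFrom⁺ suc e<2m) set)
    columnsVanish : All (λ c → lincomb (Vec.toList (Vec.replicate (length rows) true)) rows c ≡ false) (oneTo m)
    columnsVanish = All.map⁺ (All.map (λ {a} a<m → begin
      lincomb (Vec.toList (Vec.replicate (length rows) true)) rows (suc a)  ≡⟨ lincomb-all rows (suc a) ⟩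
      parity (map (λ v → v (suc a)) rows)                                    ≡⟨ parity-concatMap (λ v → v (suc a)) (rowsOf m) (allFin s) ⟩
      parity (map (λ j → parity (map (λ v → v (suc a)) (rowsOf m j))) (allFin s))
        ≡⟨ cong parity (List.map-cong (parity-rowsOf order2 m (s≤s z≤n) a<m) (allFin s)) ⟩
      parity (map (λ j → columnParity j (suc a)) (allFin s))                 ≡⟨ sym (walParity-2^-columns a) ⟩
      walParity Cm k (2 ^ a)                                                 ≡⟨ dyadicWalSum>0⇒walParity-2^ Cm k m (subst (0 <_) (sym D) (s≤s z≤n)) a<m ⟩
      false                                                                  ∎) (All.all-upTo m))
      where open ≡-Reasoning

all-selDesc : ∀ {P : ℕ → Set} M S → (∀ {r} → r ≤ M → S r ≡ true → P r) → All P (selDesc M S)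
all-selDesc zero    S _     = []
all-selDesc (suc M) S below with S (suc M) in sel
... | true  = below ≤-refl sel ∷ all-selDesc M S (below ∘ m≤n⇒m≤1+n)
... | false = all-selDesc M S (below ∘ m≤n⇒m≤1+n)

sum-take1≤ : ∀ {b} xs → All (_≤ b) xs → sum (take 1 xs) ≤ b
sum-take1≤ []       _         = z≤n
sum-take1≤ (x ∷ xs) (x≤b ∷ _) = subst (_≤ _) (sym (+-identityʳ x)) x≤b

topTwo-selDesc≤ : ∀ M S {b E} → b ≤ E → (∀ {r} → S r ≡ true → r ≤ b ⊎ r ≡ E) → topTwo (selDesc M S) ≤ E + b
topTwo-selDesc≤ zero    S b≤E rows = z≤n
topTwo-selDesc≤ (suc M) S {b} {E} b≤E rows with S (suc M) in sel
... | false = topTwo-selDesc≤ M S b≤E rows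
... | true with rows sel
...   | inj₁ 1+M≤b = +-mono-≤ (≤-trans 1+M≤b b≤E) (sum-take1≤ _ (all-selDesc M S λ r≤M _ → ≤-trans (m≤n⇒m≤1+n r≤M) 1+M≤b))
...   | inj₂ refl  = +-monoʳ-≤ (suc M) (sum-take1≤ _ (all-selDesc M S below))
  where
  below : ∀ {r} → r ≤ M → S r ≡ true → r ≤ b
  below {r} r≤M selr with rows selr
  ... | inj₁ r≤b  = r≤b
  ... | inj₂ refl = contradiction r≤M (<⇒≱ ≤-refl)

flipTop : ∀ {s} → (Fin s → ℕ) → (Fin s → ℕ) → Fin s → ℕ
flipTop ℓ z j = ℓ j ⊕ floor2^pred (z j + μ₁ (ℓ j))

BoxCoordinate : Bool → ℕ → Set
BoxCoordinate inU z₀ = (inU ≡ true → 1 ≤ z₀) × (inU ≡ false → z₀ ≡ 0)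

InBox : ∀ {s} → (Fin s → Bool) → (Fin s → ℕ) → Set
InBox u z = ∀ j → BoxCoordinate (u j) (z j)

or≡true⇒any : ∀ (f : A → Bool) xs → or (map f xs) ≡ true → Any (λ x → f x ≡ true) xs
or≡true⇒any f (x ∷ xs) some≡true with f x in fx
... | true  = here fx
... | false = there (or≡true⇒any f xs some≡true)

and≡false⇒any : ∀ (f : A → Bool) xs → and (map f xs) ≡ false → Any (λ x → f x ≡ false) xs
and≡false⇒any f (x ∷ xs) all≡false with f x in fx
... | false = here fx
... | true  = there (and≡false⇒any f xs all≡false)

module _ {s} (ℓ z : Fin s → ℕ) {u : Fin s → Bool} (box : InBox u z) where

  flipTop-nonzero-on-u : ∀ j → u j ≡ true → ∃ λ e → bit (flipTop ℓ z j) e ≡ true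
  flipTop-nonzero-on-u j uj with z j | proj₁ (box j) uj
  ... | suc z′ | _ = z′ + μ₁ (ℓ j) , bit-⊕floor2^pred-top (ℓ j) (z′ + μ₁ (ℓ j)) (m≤n+m (μ₁ (ℓ j)) z′)

  flipTop-nonzero-off-pow2 : ∀ j → zeroOrPow2 (ℓ j) ≡ false → ∃ λ e → bit (flipTop ℓ z j) e ≡ true
  flipTop-nonzero-off-pow2 j notPow2 with u j in uj
  ... | true  = flipTop-nonzero-on-u j uj
  ... | false rewrite proj₂ (box j) uj = ¬zeroOrPow2⇒bit-⊕floor2^pred (ℓ j) notPow2

  flipTop≢0 : inA ℓ u ≡ true → ∃ λ j → ∃ λ e → bit (flipTop ℓ z j) e ≡ true
  flipTop≢0 inAℓu with or (map u (allFin s)) in nonempty | and (map (zeroOrPow2 ∘ ℓ) (allFin s)) in allPow2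
  ... | true  | _     = let j , uj = Any.satisfied (or≡true⇒any u (allFin s) nonempty) in j , flipTop-nonzero-on-u j uj
  ... | false | false = let j , notPow2 = Any.satisfied (and≡false⇒any (zeroOrPow2 ∘ ℓ) (allFin s) allPow2) in j , flipTop-nonzero-off-pow2 j notPow2

sum-map-mono : ∀ {f g : A → ℕ} xs → (∀ x → f x ≤ g x) → sum (map f xs) ≤ sum (map g xs)
sum-map-mono []       f≤g = z≤n
sum-map-mono (x ∷ xs) f≤g = +-mono-≤ (f≤g x) (sum-map-mono xs f≤g)

sum-map-+ : ∀ (f g : A → ℕ) xs → sum (map (λ x → f x + g x) xs) ≡ sum (map f xs) + sum (map g xs)
sum-map-+ f g []       = refl
sum-map-+ f g (x ∷ xs) = trans (cong (f x + g x +_) (sum-map-+ f g xs)) (+-+-interchange (f x) (g x) (sum (map f xs)) (sum (map g xs)))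
  where open Algebra.Properties.CommutativeSemigroup +-commutativeSemigroup renaming (interchange to +-+-interchange)

∈⇒≤sum-map : ∀ (f : A → ℕ) {x xs} → x ∈ xs → f x ≤ sum (map f xs)
∈⇒≤sum-map f {xs = y ∷ xs} (here refl) = m≤m+n (f y) _
∈⇒≤sum-map f {xs = y ∷ xs} (there x∈xs) = ≤-trans (∈⇒≤sum-map f x∈xs) (m≤n+m _ (f y))

∈⇒≤sumFin : ∀ {s} (f : Fin s → ℕ) j → f j ≤ sumFin f
∈⇒≤sumFin f j = ∈⇒≤sum-map f (∈-allFin j)

module _ {s} {ℓ b : Fin s → ℕ} (ν≡b : ∀ j → μ₁ (ℓ j) ≡ b j) (z : Fin s → ℕ) where

  digitRows-flipTop : ∀ j {r} → digitRows (flipTop ℓ z) j r ≡ true → r ≤ b j ⊎ r ≡ z j + b j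
  digitRows-flipTop j {zero}  _   = inj₁ z≤n
  digitRows-flipTop j {suc r} set with bit-⊕floor2^pred (ℓ j) (z j + μ₁ (ℓ j)) set
  ... | inj₁ r<μ₁ = inj₁ (subst (suc r ≤_) (ν≡b j) r<μ₁)
  ... | inj₂ top  = inj₂ (trans top (cong (z j +_) (ν≡b j)))

  dyadicWalSum>0⇒weight : ∀ {t Cm u} → IsOrder2DigitalTS t s Cm → InBox u z → inA ℓ u ≡ true →
    ∀ m → 0 < dyadicWalSum Cm (flipTop ℓ z) m → 2 * m ≤ sumFin z + 2 * sumFin b + t
  dyadicWalSum>0⇒weight {t} {Cm} ts box inAℓu m D>0 = ≮⇒≥ λ W<2m → >⇒≢ D>0 (dyadicWalSum≡0 W<2m)
    where
    W = sumFin z + 2 * sumFin b + t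
    nonzero = flipTop≢0 ℓ z box inAℓu
    j = proj₁ nonzero
    e = proj₁ (proj₂ nonzero)
    set = proj₂ (proj₂ nonzero)

    weight : W < 2 * m → sum (map (λ j → topTwo (selDesc (2 * m) (digitRows (flipTop ℓ z) j))) (allFin s)) ≤ 2 * m ∸ t
    weight W<2m = begin
      sum (map (λ j → topTwo (selDesc (2 * m) (digitRows (flipTop ℓ z) j))) (allFin s))
        ≤⟨ sum-map-mono (allFin s) (λ j → topTwo-selDesc≤ (2 * m) _ (m≤n+m (b j) (z j)) (digitRows-flipTop j)) ⟩
      sum (map (λ j → (z j + b j) + b j) (allFin s))
        ≡⟨ trans (sum-map-+ (λ j → z j + b j) b (allFin s)) (cong (_+ sumFin b) (sum-map-+ z b (allFin s))) ⟩
      sumFin z + sumFin b + sumFin b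
        ≡⟨ solve 2 (λ Z B → Z :+ B :+ B := Z :+ con 2 :* B) refl (sumFin z) (sumFin b) ⟩
      sumFin z + 2 * sumFin b
        ≤⟨ m+n≤o⇒m≤o∸n _ (<⇒≤ W<2m) ⟩
      2 * m ∸ t ∎
      where
      open ≤-Reasoning
      open ℕ-Solver.+-*-Solver

    z+b≤W : z j + b j ≤ W
    z+b≤W = begin
      z j + b j                 ≤⟨ +-mono-≤ (∈⇒≤sumFin z j) (≤-trans (∈⇒≤sumFin b j) (m≤m+n (sumFin b) (sumFin b + 0))) ⟩
      sumFin z + 2 * sumFin b   ≤⟨ m≤m+n _ t ⟩
      W                         ∎
      where open ≤-Reasoning

    topRow<W : suc e ≤ b j ⊎ suc e ≡ z j + b j → e < W
    topRow<W (inj₁ 1+e≤bj)  = ≤-trans 1+e≤bj (≤-trans (m≤n+m (b j) (z j)) z+b≤W)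
    topRow<W (inj₂ 1+e≡z+b) = ≤-trans (≤-reflexive 1+e≡z+b) z+b≤W

    dyadicWalSum≡0 : W < 2 * m → dyadicWalSum Cm (flipTop ℓ z) m ≡ 0
    dyadicWalSum≡0 W<2m with e <? 2 * m
    ... | yes e<2m = smallWeight⇒dyadicWalSum≡0 Cm (flipTop ℓ z) ts m (≤-<-trans (m≤n+m t _) W<2m) (j , e , e<2m , set) (weight W<2m)
    ... | no  e≮2m = contradiction (≤-trans (≮⇒≥ e≮2m) (<⇒≤ (topRow<W (digitRows-flipTop j set)))) (<⇒≱ W<2m)

-- Rationals and finite sums

ι : ℕ → ℚ
ι n = pos n ℚ./ 1

toℚᵘ-ι : ∀ n → ℚ.toℚᵘ (ι n) ℚᵘ.≃ mkℚᵘ (pos n) 0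
toℚᵘ-ι n = ℚ.toℚᵘ-fromℚᵘ (mkℚᵘ (pos n) 0)

ι-+ : ∀ m n → ι (m + n) ≡ ι m ℚ.+ ι n
ι-+ m n = ℚ.toℚᵘ-injective (ℚᵘ.≃-trans (toℚᵘ-ι (m + n)) (ℚᵘ.≃-trans sumᵘ
  (ℚᵘ.≃-sym (ℚᵘ.≃-trans (ℚ.toℚᵘ-homo-+ (ι m) (ι n)) (ℚᵘ.+-cong (toℚᵘ-ι m) (toℚᵘ-ι n))))))
  where
  sumᵘ : mkℚᵘ (pos (m + n)) 0 ℚᵘ.≃ mkℚᵘ (pos m) 0 ℚᵘ.+ mkℚᵘ (pos n) 0
  sumᵘ = *≡* (trans (ℤ.*-identityʳ _) (trans (ℤ.pos-+ m n)
    (sym (trans (ℤ.*-identityʳ _) (cong₂ ℤ._+_ (ℤ.*-identityʳ (pos m)) (ℤ.*-identityʳ (pos n)))))))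

ι-* : ∀ m n → ι (m * n) ≡ ι m ℚ.* ι n
ι-* m n = ℚ.toℚᵘ-injective (ℚᵘ.≃-trans (toℚᵘ-ι (m * n)) (ℚᵘ.≃-trans productᵘ
  (ℚᵘ.≃-sym (ℚᵘ.≃-trans (ℚ.toℚᵘ-homo-* (ι m) (ι n)) (ℚᵘ.*-cong (toℚᵘ-ι m) (toℚᵘ-ι n))))))
  where
  productᵘ : mkℚᵘ (pos (m * n)) 0 ℚᵘ.≃ mkℚᵘ (pos m) 0 ℚᵘ.* mkℚᵘ (pos n) 0
  productᵘ = *≡* (trans (ℤ.*-identityʳ _) (trans (ℤ.pos-* m n) (sym (ℤ.*-identityʳ _))))

ι-mono-≤ : ∀ {m n} → m ≤ n → ι m ℚ.≤ ι n
ι-mono-≤ {m} {n} m≤n = ℚ.toℚᵘ-cancel-≤ (ℚᵘ.≤-respˡ-≃ (ℚᵘ.≃-sym (toℚᵘ-ι m)) (ℚᵘ.≤-respʳ-≃ (ℚᵘ.≃-sym (toℚᵘ-ι n))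
  (ℚᵘ.*≤* (subst₂ ℤ._≤_ (sym (ℤ.*-identityʳ (pos m))) (sym (ℤ.*-identityʳ (pos n))) (ℤ.+≤+ m≤n)))))

ι-nonNeg : ∀ n → 0ℚ ℚ.≤ ι n
ι-nonNeg n = ι-mono-≤ {0} {n} z≤n

ι-pos : ∀ {n} → 0 < n → 0ℚ ℚ.< ι n
ι-pos {suc n} _ = ℚ.positive⁻¹ _ {{ℚ.normalize-pos (suc n) 1}}

1/N-nonNeg : ∀ n → 0ℚ ℚ.≤ pos 1 ℚ./ suc n
1/N-nonNeg n = ℚ.nonNegative⁻¹ _ {{ℚ.normalize-nonNeg 1 (suc n)}}

∣z/N∣ : ∀ z n → ∣ z ℚ./ suc n ∣ ≡ ι ∣ z ∣ℤ ℚ.* (pos 1 ℚ./ suc n)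
∣z/N∣ z n = ℚ.toℚᵘ-injective (ℚᵘ.≃-trans (ℚ.toℚᵘ-homo-∣-∣ (z ℚ./ suc n))
  (ℚᵘ.≃-trans (ℚᵘ.∣-∣-cong (ℚ.toℚᵘ-fromℚᵘ (mkℚᵘ z n))) (ℚᵘ.≃-trans quotientᵘ
   (ℚᵘ.≃-sym (ℚᵘ.≃-trans (ℚ.toℚᵘ-homo-* (ι ∣ z ∣ℤ) (pos 1 ℚ./ suc n))
       (ℚᵘ.*-cong (toℚᵘ-ι ∣ z ∣ℤ) (ℚ.toℚᵘ-fromℚᵘ (mkℚᵘ (pos 1) n))))))))
  where
  quotientᵘ : ℚᵘ.∣ mkℚᵘ z n ∣ ℚᵘ.≃ mkℚᵘ (pos ∣ z ∣ℤ) 0 ℚᵘ.* mkℚᵘ (pos 1) n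
  quotientᵘ = *≡* (trans (cong (λ d → pos ∣ z ∣ℤ ℤ.* pos (suc d)) (+-identityʳ n))
                         (cong (ℤ._* pos (suc n)) (sym (ℤ.*-identityʳ (pos ∣ z ∣ℤ)))))

*-monoˡ-≤-nonNeg : ∀ {r p q} → 0ℚ ℚ.≤ r → p ℚ.≤ q → r ℚ.* p ℚ.≤ r ℚ.* q
*-monoˡ-≤-nonNeg {r} 0≤r p≤q = ℚ.*-monoˡ-≤-nonNeg r {{ℚ.nonNegative 0≤r}} p≤q

*-monoʳ-≤-nonNeg : ∀ {r p q} → 0ℚ ℚ.≤ r → p ℚ.≤ q → p ℚ.* r ℚ.≤ q ℚ.* r
*-monoʳ-≤-nonNeg {r} 0≤r p≤q = ℚ.*-monoʳ-≤-nonNeg r {{ℚ.nonNegative 0≤r}} p≤q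

*-nonNeg : ∀ {p q} → 0ℚ ℚ.≤ p → 0ℚ ℚ.≤ q → 0ℚ ℚ.≤ p ℚ.* q
*-nonNeg {p} 0≤p 0≤q = ℚ.≤-trans (ℚ.≤-reflexive (sym (ℚ.*-zeroʳ p))) (*-monoˡ-≤-nonNeg 0≤p 0≤q)

Σℚ : List A → (A → ℚ) → ℚ
Σℚ xs f = foldr (λ x acc → f x ℚ.+ acc) 0ℚ xs

Σℚ-++ : ∀ (f : A → ℚ) xs ys → Σℚ (xs ++ ys) f ≡ Σℚ xs f ℚ.+ Σℚ ys f
Σℚ-++ f []       ys = sym (ℚ.+-identityˡ _)
Σℚ-++ f (x ∷ xs) ys = trans (cong (f x ℚ.+_) (Σℚ-++ f xs ys)) (sym (ℚ.+-assoc (f x) _ _))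

Σℚ-concatMap : ∀ (f : A′ → ℚ) (F : A → List A′) xs → Σℚ (concatMap F xs) f ≡ Σℚ xs (λ x → Σℚ (F x) f)
Σℚ-concatMap f F []       = refl
Σℚ-concatMap f F (x ∷ xs) = trans (Σℚ-++ f (F x) (concatMap F xs)) (cong (Σℚ (F x) f ℚ.+_) (Σℚ-concatMap f F xs))

Σℚ-map : ∀ (f : A′ → ℚ) (g : A → A′) xs → Σℚ (map g xs) f ≡ Σℚ xs (f ∘ g)
Σℚ-map f g []       = refl
Σℚ-map f g (x ∷ xs) = cong (f (g x) ℚ.+_) (Σℚ-map f g xs)

Σℚ-cong : ∀ {f g : A → ℚ} xs → (∀ x → f x ≡ g x) → Σℚ xs f ≡ Σℚ xs g
Σℚ-cong []       f≗g = refl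
Σℚ-cong (x ∷ xs) f≗g = cong₂ ℚ._+_ (f≗g x) (Σℚ-cong xs f≗g)

Σℚ-*ˡ : ∀ c (f : A → ℚ) xs → Σℚ xs (λ x → c ℚ.* f x) ≡ c ℚ.* Σℚ xs f
Σℚ-*ˡ c f []       = sym (ℚ.*-zeroʳ c)
Σℚ-*ˡ c f (x ∷ xs) = trans (cong (c ℚ.* f x ℚ.+_) (Σℚ-*ˡ c f xs)) (sym (ℚ.*-distribˡ-+ c (f x) (Σℚ xs f)))

Σℚ-+ : ∀ (f g : A → ℚ) xs → Σℚ xs (λ x → f x ℚ.+ g x) ≡ Σℚ xs f ℚ.+ Σℚ xs g
Σℚ-+ f g []       = refl
Σℚ-+ f g (x ∷ xs) = trans (cong ((f x ℚ.+ g x) ℚ.+_) (Σℚ-+ f g xs))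
  (solve 4 (λ a b c d → (a :+ b) :+ (c :+ d) := (a :+ c) :+ (b :+ d)) refl (f x) (g x) (Σℚ xs f) (Σℚ xs g))
  where open ℚ-Solver.+-*-Solver

Σℚ-0 : ∀ (xs : List A) → Σℚ xs (λ _ → 0ℚ) ≡ 0ℚ
Σℚ-0 []       = refl
Σℚ-0 (x ∷ xs) = trans (ℚ.+-identityˡ _) (Σℚ-0 xs)

Σℚ-comm : ∀ (g : A → A′ → ℚ) xs ys → Σℚ xs (λ x → Σℚ ys (g x)) ≡ Σℚ ys (λ y → Σℚ xs (λ x → g x y))
Σℚ-comm g []       ys = sym (Σℚ-0 ys)
Σℚ-comm g (x ∷ xs) ys = trans (cong (Σℚ ys (g x) ℚ.+_) (Σℚ-comm g xs ys)) (sym (Σℚ-+ (g x) _ ys))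

Σℚ-mono-All : ∀ {f g : A → ℚ} {xs} → All (λ x → f x ℚ.≤ g x) xs → Σℚ xs f ℚ.≤ Σℚ xs g
Σℚ-mono-All []          = ℚ.≤-refl
Σℚ-mono-All (fx≤gx ∷ ps) = ℚ.+-mono-≤ fx≤gx (Σℚ-mono-All ps)

Σℚ-mono : ∀ {f g : A → ℚ} xs → (∀ x → f x ℚ.≤ g x) → Σℚ xs f ℚ.≤ Σℚ xs g
Σℚ-mono []       f≤g = ℚ.≤-refl
Σℚ-mono (x ∷ xs) f≤g = ℚ.+-mono-≤ (f≤g x) (Σℚ-mono xs f≤g)

Σℚ-nonNeg : ∀ {f : A → ℚ} xs → (∀ x → 0ℚ ℚ.≤ f x) → 0ℚ ℚ.≤ Σℚ xs f
Σℚ-nonNeg xs 0≤f = ℚ.≤-trans (ℚ.≤-reflexive (sym (Σℚ-0 xs))) (Σℚ-mono xs 0≤f)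

∣Σℚ∣≤Σℚ∣∣ : ∀ (f : A → ℚ) xs → ∣ Σℚ xs f ∣ ℚ.≤ Σℚ xs (λ x → ∣ f x ∣)
∣Σℚ∣≤Σℚ∣∣ f []       = ℚ.≤-refl
∣Σℚ∣≤Σℚ∣∣ f (x ∷ xs) = ℚ.≤-trans (ℚ.∣p+q∣≤∣p∣+∣q∣ (f x) (Σℚ xs f)) (ℚ.+-monoʳ-≤ ∣ f x ∣ (∣Σℚ∣≤Σℚ∣∣ f xs))

ι-sum : ∀ (f : A → ℕ) xs → ι (sum (map f xs)) ≡ Σℚ xs (ι ∘ f)
ι-sum f []       = refl
ι-sum f (x ∷ xs) = trans (ι-+ (f x) _) (cong (ι (f x) ℚ.+_) (ι-sum f xs))

Σℚ-const : ∀ c (xs : List A) → Σℚ xs (λ _ → c) ≡ ι (length xs) ℚ.* c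
Σℚ-const c []       = sym (ℚ.*-zeroˡ c)
Σℚ-const c (x ∷ xs) = begin
  c ℚ.+ Σℚ xs (λ _ → c)            ≡⟨ cong (c ℚ.+_) (Σℚ-const c xs) ⟩
  c ℚ.+ ι (length xs) ℚ.* c        ≡⟨ solve 2 (λ c n → c :+ n :* c := (con 1ℚ :+ n) :* c) refl c (ι (length xs)) ⟩
  (1ℚ ℚ.+ ι (length xs)) ℚ.* c     ≡⟨ cong (ℚ._* c) (sym (ι-+ 1 (length xs))) ⟩
  ι (suc (length xs)) ℚ.* c        ∎
  where
  open ≡-Reasoning
  open ℚ-Solver.+-*-Solver

inv2^-+ : ∀ a b → inv2^ (a + b) ≡ inv2^ a ℚ.* inv2^ b
inv2^-+ zero    b = sym (ℚ.*-identityˡ _)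
inv2^-+ (suc a) b = trans (cong (½ ℚ.*_) (inv2^-+ a b)) (sym (ℚ.*-assoc ½ (inv2^ a) (inv2^ b)))

inv2^-nonNeg : ∀ a → 0ℚ ℚ.≤ inv2^ a
inv2^-nonNeg zero    = ℚ.nonNegative⁻¹ 1ℚ
inv2^-nonNeg (suc a) = *-nonNeg (ℚ.nonNegative⁻¹ ½) (inv2^-nonNeg a)

inv2^*2^≡1 : ∀ a → inv2^ a ℚ.* ι (2 ^ a) ≡ 1ℚ
inv2^*2^≡1 zero    = refl
inv2^*2^≡1 (suc a) = begin
  ½ ℚ.* inv2^ a ℚ.* ι (2 * 2 ^ a)               ≡⟨ cong (½ ℚ.* inv2^ a ℚ.*_) (ι-* 2 (2 ^ a)) ⟩
  ½ ℚ.* inv2^ a ℚ.* (ι 2 ℚ.* ι (2 ^ a))         ≡⟨ solve 4 (λ h x t y → h :* x :* (t :* y) := h :* t :* (x :* y)) refl ½ (inv2^ a) (ι 2) (ι (2 ^ a)) ⟩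
  ½ ℚ.* ι 2 ℚ.* (inv2^ a ℚ.* ι (2 ^ a))         ≡⟨ cong (½ ℚ.* ι 2 ℚ.*_) (inv2^*2^≡1 a) ⟩
  1ℚ                                             ∎
  where
  open ≡-Reasoning
  open ℚ-Solver.+-*-Solver

Σℚ-upTo-suc : ∀ (h : ℕ → ℚ) n → Σℚ (upTo (suc n)) h ≡ h 0 ℚ.+ Σℚ (upTo n) (h ∘ suc)
Σℚ-upTo-suc h n = cong (h 0 ℚ.+_) (trans (cong (λ xs → Σℚ xs h) (sym (List.map-applyUpTo id suc n))) (Σℚ-map h suc (upTo n)))

≤-+-nonNeg : ∀ {p q} ε → 0ℚ ℚ.≤ ε → p ℚ.≤ q → p ℚ.≤ q ℚ.+ ε
≤-+-nonNeg {q = q} ε 0≤ε p≤q = ℚ.≤-trans p≤q (ℚ.≤-trans (ℚ.≤-reflexive (sym (ℚ.+-identityʳ q))) (ℚ.+-monoʳ-≤ q 0≤ε))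

-- Sums over the summation box

tail2^ : ℕ → ℕ → ℚ
tail2^ M X with M ≤? X
... | yes _ = inv2^ X
... | no  _ = 0ℚ

tail2^-nonNeg : ∀ M X → 0ℚ ℚ.≤ tail2^ M X
tail2^-nonNeg M X with M ≤? X
... | yes _ = inv2^-nonNeg X
... | no  _ = ℚ.≤-refl

tail2^-+ : ∀ M a X → tail2^ M (a + X) ≡ inv2^ a ℚ.* tail2^ (M ∸ a) X
tail2^-+ M a X with M ≤? a + X | M ∸ a ≤? X
... | yes _     | yes _      = inv2^-+ a X
... | no  _     | no  _      = sym (ℚ.*-zeroʳ (inv2^ a))
... | yes M≤a+X | no  M∸a≰X  = contradiction (m≤n+o⇒m∸n≤o M a M≤a+X) M∸a≰X
... | no  M≰a+X | yes M∸a≤X  = contradiction (≤-trans (m≤n+m∸n M a) (+-monoʳ-≤ a M∸a≤X)) M≰a+X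

tailSum : (ℕ → ℕ) → ℕ → ℕ
tailSum q zero    = q 0
tailSum q (suc M) = q M + tailSum q M

-- boxTail s M bounds 2^M times the 2^(-|z|)-mass of the z ∈ ℕ^s with |z| ≥ M.
boxTail : ℕ → ℕ → ℕ
boxTail zero    zero    = 1
boxTail zero    (suc M) = 0
boxTail (suc s) M       = boxTail s M + tailSum (boxTail s) M

module _ (q : ℕ → ℕ) where

  slice : ℕ → ℕ → ℚ
  slice M z₀ = inv2^ z₀ ℚ.* (inv2^ (M ∸ z₀) ℚ.* ι (q (M ∸ z₀)))

  slice-suc : ∀ M i → slice M (suc (suc i)) ≡ ½ ℚ.* slice (M ∸ 1) (suc i)
  slice-suc zero    i = ℚ.*-assoc ½ (inv2^ (suc i)) _
  slice-suc (suc M) i = ℚ.*-assoc ½ (inv2^ (suc i)) _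

  -- Slices with z₀ ≤ M each contribute 2^(-M) q (M - z₀); those with z₀ > M sum geometrically to at most 2^(-M) q 0.
  Σslice≤ : ∀ Z M → Σℚ (upTo Z) (λ i → slice M (suc i)) ℚ.≤ inv2^ M ℚ.* ι (tailSum q M)
  Σslice≤ zero    M = *-nonNeg (inv2^-nonNeg M) (ι-nonNeg (tailSum q M))
  Σslice≤ (suc Z) M = begin
    Σℚ (upTo (suc Z)) (λ i → slice M (suc i))
      ≡⟨ Σℚ-upTo-suc (λ i → slice M (suc i)) Z ⟩
    slice M 1 ℚ.+ Σℚ (upTo Z) (λ i → slice M (suc (suc i)))
      ≡⟨ cong (slice M 1 ℚ.+_) (trans (Σℚ-cong (upTo Z) (slice-suc M)) (Σℚ-*ˡ ½ (λ i → slice (M ∸ 1) (suc i)) (upTo Z))) ⟩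
    slice M 1 ℚ.+ ½ ℚ.* Σℚ (upTo Z) (λ i → slice (M ∸ 1) (suc i))
      ≤⟨ ℚ.+-monoʳ-≤ (slice M 1) (*-monoˡ-≤-nonNeg (ℚ.nonNegative⁻¹ ½) (Σslice≤ Z (M ∸ 1))) ⟩
    slice M 1 ℚ.+ ½ ℚ.* (inv2^ (M ∸ 1) ℚ.* ι (tailSum q (M ∸ 1)))
      ≡⟨ halves M ⟩
    inv2^ M ℚ.* ι (tailSum q M) ∎
    where
    open ℚ.≤-Reasoning
    open ℚ-Solver.+-*-Solver
    halves : ∀ M → slice M 1 ℚ.+ ½ ℚ.* (inv2^ (M ∸ 1) ℚ.* ι (tailSum q (M ∸ 1))) ≡ inv2^ M ℚ.* ι (tailSum q M)
    halves zero    = solve 1 (λ x → con ½ :* con 1ℚ :* (con 1ℚ :* x) :+ con ½ :* (con 1ℚ :* x) := con 1ℚ :* x) refl (ι (q 0))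
    halves (suc M) = trans (solve 4 (λ h a x y → h :* (a :* x) :+ h :* (a :* y) := (h :* a) :* (x :+ y)) refl ½ (inv2^ M) (ι (q M)) (ι (tailSum q M)))
                           (cong (½ ℚ.* inv2^ M ℚ.*_) (sym (ι-+ (q M) (tailSum q M))))

sumFin-cons : ∀ {s} (h : Fin (suc s) → ℕ) → sumFin h ≡ h Fin.zero + sumFin (h ∘ Fin.suc)
sumFin-cons {s} h = cong (h Fin.zero +_) (trans (cong sum (List.map-tabulate Fin.suc h)) (sym (cong sum (List.map-tabulate id (h ∘ Fin.suc)))))

-- φ is abstract because box builds its points with a pattern-matching lambda, to which no term written here is definitionally equal.
Σℚ-split-tail2^ : ∀ {s} (φ : ℕ → (Fin s → ℕ) → Fin (suc s) → ℕ) (L : List ℕ) (bx : List (Fin s → ℕ)) →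
  (∀ z₀ g → φ z₀ g Fin.zero ≡ z₀) → (∀ z₀ g j → φ z₀ g (Fin.suc j) ≡ g j) →
  (∀ M → Σℚ bx (tail2^ M ∘ sumFin) ℚ.≤ inv2^ M ℚ.* ι (boxTail s M)) →
  ∀ M → Σℚ (concatMap (λ z₀ → map (φ z₀) bx) L) (tail2^ M ∘ sumFin) ℚ.≤ Σℚ L (slice (boxTail s) M)
Σℚ-split-tail2^ {s} φ L bx φ-zero φ-suc bxBound M = begin
  Σℚ (concatMap (λ z₀ → map (φ z₀) bx) L) (tail2^ M ∘ sumFin)
    ≡⟨ Σℚ-concatMap (tail2^ M ∘ sumFin) (λ z₀ → map (φ z₀) bx) L ⟩
  Σℚ L (λ z₀ → Σℚ (map (φ z₀) bx) (tail2^ M ∘ sumFin))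
    ≡⟨ Σℚ-cong L (λ z₀ → trans (Σℚ-map (tail2^ M ∘ sumFin) (φ z₀) bx) (Σℚ-cong bx λ g → cong (tail2^ M) (sumFin-φ z₀ g))) ⟩
  Σℚ L (λ z₀ → Σℚ bx (λ g → tail2^ M (z₀ + sumFin g)))
    ≡⟨ Σℚ-cong L (λ z₀ → trans (Σℚ-cong bx λ g → tail2^-+ M z₀ (sumFin g)) (Σℚ-*ˡ (inv2^ z₀) _ bx)) ⟩
  Σℚ L (λ z₀ → inv2^ z₀ ℚ.* Σℚ bx (tail2^ (M ∸ z₀) ∘ sumFin))
    ≤⟨ Σℚ-mono L (λ z₀ → *-monoˡ-≤-nonNeg (inv2^-nonNeg z₀) (bxBound (M ∸ z₀))) ⟩
  Σℚ L (slice (boxTail s) M) ∎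
  where
  open ℚ.≤-Reasoning
  sumFin-φ : ∀ z₀ g → sumFin (φ z₀ g) ≡ z₀ + sumFin g
  sumFin-φ z₀ g = trans (sumFin-cons (φ z₀ g)) (cong₂ _+_ (φ-zero z₀ g) (cong sum (List.map-cong (φ-suc z₀ g) (allFin s))))

Σslice-first≤ : ∀ s Z M b → Σℚ (if b then oneTo Z else 0 ∷ []) (slice (boxTail s) M) ℚ.≤ inv2^ M ℚ.* ι (boxTail (suc s) M)
Σslice-first≤ s Z M true  = ℚ.≤-trans (ℚ.≤-reflexive (Σℚ-map (slice (boxTail s) M) suc (upTo Z)))
  (ℚ.≤-trans (Σslice≤ (boxTail s) Z M) (*-monoˡ-≤-nonNeg (inv2^-nonNeg M) (ι-mono-≤ (m≤n+m (tailSum (boxTail s) M) (boxTail s M)))))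
Σslice-first≤ s Z M false = ℚ.≤-trans (ℚ.≤-reflexive (trans (ℚ.+-identityʳ _) (ℚ.*-identityˡ _)))
  (*-monoˡ-≤-nonNeg (inv2^-nonNeg M) (ι-mono-≤ (m≤m+n (boxTail s M) (tailSum (boxTail s) M))))

Σbox-tail2^≤ : ∀ s (u : Fin s → Bool) Z M → Σℚ (box s u Z) (tail2^ M ∘ sumFin) ℚ.≤ inv2^ M ℚ.* ι (boxTail s M)
Σbox-tail2^≤ zero    u Z zero    = ℚ.≤-refl
Σbox-tail2^≤ zero    u Z (suc M) = *-nonNeg (inv2^-nonNeg (suc M)) (ι-nonNeg 0)
Σbox-tail2^≤ (suc s) u Z M       = ℚ.≤-trans
  (Σℚ-split-tail2^ _ (if u Fin.zero then oneTo Z else 0 ∷ []) (box s (u ∘ Fin.suc) Z) (λ _ _ → refl) (λ _ _ _ → refl) (Σbox-tail2^≤ s (u ∘ Fin.suc) Z) M)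
  (Σslice-first≤ s Z M (u Fin.zero))

InBox-cons : ∀ {s} {u : Fin (suc s) → Bool} (h : Fin (suc s) → ℕ) →
  BoxCoordinate (u Fin.zero) (h Fin.zero) → InBox (u ∘ Fin.suc) (h ∘ Fin.suc) → InBox u h
InBox-cons h first rest Fin.zero    = first
InBox-cons h first rest (Fin.suc j) = rest j

all-BoxCoordinate : ∀ inU Z → All (BoxCoordinate inU) (if inU then oneTo Z else 0 ∷ [])
all-BoxCoordinate inU Z with inU
... | true  = All.map⁺ (All.applyUpTo⁺₂ id Z λ _ → (λ _ → s≤s z≤n) , λ ())
... | false = ((λ ()) , λ _ → refl) ∷ []

all-InBox : ∀ s (u : Fin s → Bool) Z → All (InBox u) (box s u Z)
all-InBox zero    u Z = (λ ()) ∷ []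
all-InBox (suc s) u Z = All.concat⁺ (All.map⁺ (All.map (λ first → All.map⁺ (All.map (λ rest → InBox-cons _ first rest) (all-InBox s (u ∘ Fin.suc) Z))) (all-BoxCoordinate (u Fin.zero) Z)))

-- Binomial bounds

C-monoˡ-≤ : ∀ {m n} k → m ≤ n → m C k ≤ n C k
C-monoˡ-≤ {m} {n} k m≤n = subst (λ x → m C k ≤ x C k) (m+[n∸m]≡n m≤n) (grow (n ∸ m))
  where
  grow : ∀ d → m C k ≤ (m + d) C k
  grow zero    = ≤-reflexive (cong (_C k) (sym (+-identityʳ m)))
  grow (suc d) = ≤-trans (grow d) (≤-trans (step (m + d) k) (≤-reflexive (cong (_C k) (sym (+-suc m d)))))
    where
    step : ∀ n k → n C k ≤ suc n C k
    step n zero    = ≤-refl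
    step n (suc k) = ≤-trans (m≤n+m (n C suc k) (n C k)) (≤-reflexive (nCk+nC[k+1]≡[n+1]C[k+1] n k))

prefixSum : (ℕ → ℕ) → ℕ → ℕ
prefixSum p zero    = p 0
prefixSum p (suc M) = p (suc M) + prefixSum p M

prefixSum-mono : ∀ {p q} M → (∀ i → p i ≤ q i) → prefixSum p M ≤ prefixSum q M
prefixSum-mono zero    p≤q = p≤q 0
prefixSum-mono (suc M) p≤q = +-mono-≤ (p≤q (suc M)) (prefixSum-mono M p≤q)

prefixSum-*ˡ : ∀ c p M → prefixSum (λ i → c * p i) M ≡ c * prefixSum p M
prefixSum-*ˡ c p zero    = refl
prefixSum-*ˡ c p (suc M) = trans (cong (c * p (suc M) +_) (prefixSum-*ˡ c p M)) (sym (*-distribˡ-+ c (p (suc M)) (prefixSum p M)))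

hockey-stick : ∀ s M → prefixSum (λ i → (i + s) C s) M ≡ (M + suc s) C suc s
hockey-stick s zero    = trans (nCn≡1 s) (sym (nCn≡1 (suc s)))
hockey-stick s (suc M) = begin
  (suc M + s) C s + prefixSum (λ i → (i + s) C s) M ≡⟨ cong ((suc M + s) C s +_) (hockey-stick s M) ⟩
  (suc M + s) C s + (M + suc s) C suc s          ≡⟨ cong (λ x → (suc M + s) C s + x C suc s) (+-suc M s) ⟩
  (suc M + s) C s + (suc M + s) C suc s          ≡⟨ nCk+nC[k+1]≡[n+1]C[k+1] (suc M + s) s ⟩
  suc (suc M + s) C suc s                        ≡⟨ cong (_C suc s) (sym (+-suc (suc M) s)) ⟩
  (suc M + suc s) C suc s                        ∎
  where open ≡-Reasoning

tailSum+≤2*prefixSum : ∀ p M → tailSum p M + p M ≤ 2 * prefixSum p M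
tailSum+≤2*prefixSum p zero    = ≤-reflexive (cong (p 0 +_) (sym (+-identityʳ (p 0))))
tailSum+≤2*prefixSum p (suc M) = begin
  (p M + tailSum p M) + p (suc M)              ≡⟨ +-comm (p M + tailSum p M) (p (suc M)) ⟩
  p (suc M) + (p M + tailSum p M)              ≤⟨ +-mono-≤ (m≤m+n (p (suc M)) (p (suc M) + 0)) (≤-trans (≤-reflexive (+-comm (p M) (tailSum p M))) (tailSum+≤2*prefixSum p M)) ⟩
  (p (suc M) + (p (suc M) + 0)) + 2 * prefixSum p M ≡⟨ sym (*-distribˡ-+ 2 (p (suc M)) (prefixSum p M)) ⟩
  2 * prefixSum p (suc M)                      ∎
  where open ≤-Reasoning

boxTail-1 : ∀ M → boxTail 1 M ≡ 2
boxTail-1 zero    = refl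
boxTail-1 (suc M) = tailSum-boxTail-0 M
  where
  tailSum-boxTail-0 : ∀ M → tailSum (boxTail 0) (suc M) ≡ 2
  tailSum-boxTail-0 zero    = refl
  tailSum-boxTail-0 (suc M) = tailSum-boxTail-0 M

boxTail≤binomial : ∀ s M → boxTail (suc s) M ≤ 2 ^ suc s * ((M + s) C s)
boxTail≤binomial zero    M = ≤-reflexive (boxTail-1 M)
boxTail≤binomial (suc s) M = begin
  boxTail (suc s) M + tailSum (boxTail (suc s)) M ≡⟨ +-comm (boxTail (suc s) M) _ ⟩
  tailSum (boxTail (suc s)) M + boxTail (suc s) M ≤⟨ tailSum+≤2*prefixSum (boxTail (suc s)) M ⟩
  2 * prefixSum (boxTail (suc s)) M                ≤⟨ *-monoʳ-≤ 2 (prefixSum-mono M (λ i → boxTail≤binomial s i)) ⟩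
  2 * prefixSum (λ i → 2 ^ suc s * ((i + s) C s)) M ≡⟨ cong (2 *_) (prefixSum-*ˡ (2 ^ suc s) (λ i → (i + s) C s) M) ⟩
  2 * (2 ^ suc s * prefixSum (λ i → (i + s) C s) M) ≡⟨ cong (λ x → 2 * (2 ^ suc s * x)) (hockey-stick s M) ⟩
  2 * (2 ^ suc s * ((M + suc s) C suc s))          ≡⟨ sym (*-assoc 2 (2 ^ suc s) _) ⟩
  2 ^ suc (suc s) * ((M + suc s) C suc s)          ∎
  where open ≤-Reasoning

-- Powers of two

2^*inv2^-shift : ∀ a x y → ι (2 ^ a) ℚ.* inv2^ x ≡ ι (2 ^ (a + y)) ℚ.* inv2^ (x + y)
2^*inv2^-shift a x y = begin
  ι (2 ^ a) ℚ.* inv2^ x                                  ≡⟨ sym (ℚ.*-identityʳ _) ⟩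
  ι (2 ^ a) ℚ.* inv2^ x ℚ.* 1ℚ                           ≡⟨ cong (ι (2 ^ a) ℚ.* inv2^ x ℚ.*_) (sym (trans (ℚ.*-comm (ι (2 ^ y)) (inv2^ y)) (inv2^*2^≡1 y))) ⟩
  ι (2 ^ a) ℚ.* inv2^ x ℚ.* (ι (2 ^ y) ℚ.* inv2^ y)
    ≡⟨ solve 4 (λ p q r w → p :* q :* (r :* w) := (p :* r) :* (q :* w)) refl (ι (2 ^ a)) (inv2^ x) (ι (2 ^ y)) (inv2^ y) ⟩
  ι (2 ^ a) ℚ.* ι (2 ^ y) ℚ.* (inv2^ x ℚ.* inv2^ y)     ≡⟨ sym (cong₂ ℚ._*_ (trans (cong ι (^-distribˡ-+-* 2 a y)) (ι-* (2 ^ a) (2 ^ y))) (inv2^-+ x y)) ⟩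
  ι (2 ^ (a + y)) ℚ.* inv2^ (x + y)                      ∎
  where
  open ≡-Reasoning
  open ℚ-Solver.+-*-Solver

2^*inv2^-mono : ∀ a x c y → a + y ≤ c + x → ι (2 ^ a) ℚ.* inv2^ x ℚ.≤ ι (2 ^ c) ℚ.* inv2^ y
2^*inv2^-mono a x c y a+y≤c+x = begin
  ι (2 ^ a) ℚ.* inv2^ x                 ≡⟨ 2^*inv2^-shift a x y ⟩
  ι (2 ^ (a + y)) ℚ.* inv2^ (x + y)     ≤⟨ *-monoʳ-≤-nonNeg (inv2^-nonNeg (x + y)) (ι-mono-≤ (^-monoʳ-≤ 2 a+y≤c+x)) ⟩
  ι (2 ^ (c + x)) ℚ.* inv2^ (x + y)     ≡⟨ cong (λ e → ι (2 ^ (c + x)) ℚ.* inv2^ e) (+-comm x y) ⟩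
  ι (2 ^ (c + x)) ℚ.* inv2^ (y + x)     ≡⟨ sym (2^*inv2^-shift c y x) ⟩
  ι (2 ^ c) ℚ.* inv2^ y                 ∎
  where open ℚ.≤-Reasoning

pow2ℤ-neg : ∀ d → pow2ℤ (ℤ.- pos d) ≡ inv2^ d
pow2ℤ-neg zero    = refl
pow2ℤ-neg (suc d) = refl

exponent≡-distance : ∀ m B → pos m ℤ.- pos B ℤ.- pos 2 ℤ.* pos (m ∸ B) ≡ ℤ.- pos ((m ∸ B) + (B ∸ m))
exponent≡-distance m B with ≤-total B m
... | inj₁ B≤m with e , refl ← m≤n⇒∃[o]m+o≡n B≤m = begin
  pos (B + e) ℤ.- pos B ℤ.- pos 2 ℤ.* pos (B + e ∸ B)   ≡⟨ cong (λ x → pos (B + e) ℤ.- pos B ℤ.- pos 2 ℤ.* pos x) (m+n∸m≡n B e) ⟩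
  pos (B + e) ℤ.- pos B ℤ.- pos 2 ℤ.* pos e             ≡⟨ cong (λ x → x ℤ.- pos B ℤ.- pos 2 ℤ.* pos e) (ℤ.pos-+ B e) ⟩
  pos B ℤ.+ pos e ℤ.- pos B ℤ.- pos 2 ℤ.* pos e         ≡⟨ solve 2 (λ b x → b :+ x :- b :- con (pos 2) :* x := :- x) refl (pos B) (pos e) ⟩
  ℤ.- pos e                                             ≡⟨ cong (λ x → ℤ.- pos x) (sym (trans (cong₂ _+_ (m+n∸m≡n B e) (m≤n⇒m∸n≡0 (m≤m+n B e))) (+-identityʳ e))) ⟩
  ℤ.- pos ((B + e ∸ B) + (B ∸ (B + e)))                 ∎
  where
  open ≡-Reasoning
  open ℤ-Solver.+-*-Solver
... | inj₂ m≤B with e , refl ← m≤n⇒∃[o]m+o≡n m≤B = begin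
  pos m ℤ.- pos (m + e) ℤ.- pos 2 ℤ.* pos (m ∸ (m + e)) ≡⟨ cong (λ x → pos m ℤ.- pos (m + e) ℤ.- pos 2 ℤ.* pos x) (m≤n⇒m∸n≡0 (m≤m+n m e)) ⟩
  pos m ℤ.- pos (m + e) ℤ.- pos 2 ℤ.* pos 0             ≡⟨ cong (λ x → pos m ℤ.- x ℤ.- pos 2 ℤ.* pos 0) (ℤ.pos-+ m e) ⟩
  pos m ℤ.- (pos m ℤ.+ pos e) ℤ.- pos 2 ℤ.* pos 0       ≡⟨ solve 2 (λ a x → a :- (a :+ x) :- con (pos 2) :* con (pos 0) := :- x) refl (pos m) (pos e) ⟩
  ℤ.- pos e                                             ≡⟨ cong (λ x → ℤ.- pos x) (sym (cong₂ _+_ (m≤n⇒m∸n≡0 (m≤m+n m e)) (m+n∸m≡n m e))) ⟩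
  ℤ.- pos ((m ∸ (m + e)) + (m + e ∸ m))                 ∎
  where
  open ≡-Reasoning
  open ℤ-Solver.+-*-Solver

exponent-budget : ∀ t B m → m + ((m ∸ B) + (B ∸ m)) ≤ t + (B + (2 * m ∸ (2 * B + t)))
exponent-budget t B m with ≤-total B m
... | inj₁ B≤m with e , refl ← m≤n⇒∃[o]m+o≡n B≤m = +-cancelˡ-≤ B _ _ (begin
  B + (B + e + ((B + e ∸ B) + (B ∸ (B + e))))  ≡⟨ cong (λ x → B + (B + e + x)) (trans (cong₂ _+_ (m+n∸m≡n B e) (m≤n⇒m∸n≡0 (m≤m+n B e))) (+-identityʳ e)) ⟩
  B + (B + e + e)                              ≡⟨ solve 2 (λ b e → b :+ (b :+ e :+ e) := con 2 :* (b :+ e)) refl B e ⟩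
  2 * (B + e)                                  ≤⟨ m≤n+m∸n (2 * (B + e)) (2 * B + t) ⟩
  2 * B + t + (2 * (B + e) ∸ (2 * B + t))      ≡⟨ solve 3 (λ b t M → con 2 :* b :+ t :+ M := b :+ (t :+ (b :+ M))) refl B t (2 * (B + e) ∸ (2 * B + t)) ⟩
  B + (t + (B + (2 * (B + e) ∸ (2 * B + t))))  ∎)
  where
  open ≤-Reasoning
  open ℕ-Solver.+-*-Solver
... | inj₂ m≤B with e , refl ← m≤n⇒∃[o]m+o≡n m≤B = begin
  m + ((m ∸ (m + e)) + (m + e ∸ m))            ≡⟨ cong (m +_) (cong₂ _+_ (m≤n⇒m∸n≡0 (m≤m+n m e)) (m+n∸m≡n m e)) ⟩
  m + e                                        ≤⟨ m≤n+m (m + e) t ⟩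
  t + (m + e)                                  ≤⟨ +-monoʳ-≤ t (m≤m+n (m + e) _) ⟩
  t + (m + e + (2 * m ∸ (2 * (m + e) + t)))    ∎
  where open ≤-Reasoning

dyadicFactor≤ : ∀ t B m → inv2^ B ℚ.* ι (2 ^ m) ℚ.* inv2^ (2 * m ∸ (2 * B + t)) ℚ.≤ ι (2 ^ t) ℚ.* pow2ℤ (pos m ℤ.- pos B ℤ.- pos 2 ℤ.* pos (m ∸ B))
dyadicFactor≤ t B m = begin
  inv2^ B ℚ.* ι (2 ^ m) ℚ.* inv2^ M   ≡⟨ solve 3 (λ b p x → b :* p :* x := p :* (b :* x)) refl (inv2^ B) (ι (2 ^ m)) (inv2^ M) ⟩
  ι (2 ^ m) ℚ.* (inv2^ B ℚ.* inv2^ M) ≡⟨ cong (ι (2 ^ m) ℚ.*_) (sym (inv2^-+ B M)) ⟩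
  ι (2 ^ m) ℚ.* inv2^ (B + M)         ≤⟨ 2^*inv2^-mono m (B + M) t d (exponent-budget t B m) ⟩
  ι (2 ^ t) ℚ.* inv2^ d               ≡⟨ cong (ι (2 ^ t) ℚ.*_) (sym (trans (cong pow2ℤ (exponent≡-distance m B)) (pow2ℤ-neg d))) ⟩
  ι (2 ^ t) ℚ.* pow2ℤ (pos m ℤ.- pos B ℤ.- pos 2 ℤ.* pos (m ∸ B)) ∎
  where
  open ℚ.≤-Reasoning
  open ℚ-Solver.+-*-Solver
  M = 2 * m ∸ (2 * B + t)
  d = (m ∸ B) + (B ∸ m)

-- The bound on c(ℓ)

length-concatMap-const : ∀ (f : A → List A′) {k} → (∀ x → length (f x) ≡ k) → ∀ xs → length (concatMap f xs) ≡ k * length xs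
length-concatMap-const f {k} ∣f∣≡k []       = sym (*-zeroʳ k)
length-concatMap-const f {k} ∣f∣≡k (x ∷ xs) = begin
  length (f x ++ concatMap f xs)       ≡⟨ List.length-++ (f x) ⟩
  length (f x) + length (concatMap f xs) ≡⟨ cong₂ _+_ (∣f∣≡k x) (length-concatMap-const f ∣f∣≡k xs) ⟩
  k + k * length xs                    ≡⟨ sym (*-suc k (length xs)) ⟩
  k * suc (length xs)                  ∎
  where open ≡-Reasoning

length-allSubsets : ∀ s → length (allSubsets s) ≡ 2 ^ s
length-allSubsets zero    = refl
length-allSubsets (suc s) = trans (length-concatMap-const _ (λ _ → refl) (allSubsets s)) (cong (2 *_) (length-allSubsets s))

∣sign∣ : ∀ e → ∣ sign e ∣ ≡ 1ℚ
∣sign∣ e with bit e 0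
... | true  = refl
... | false = refl

module _ {s t} {Cm : GenMatrices s} (ts : IsOrder2DigitalTS t s Cm) {b ℓ : Fin s → ℕ} (ν≡b : ∀ j → μ₁ (ℓ j) ≡ b j) where

  cutoff : ℕ → ℕ
  cutoff m = 2 * m ∸ (2 * sumFin b + t)

  -- Bound for the (z, m)-contribution, after the weight bound has killed the small |z|.
  ψ : ℕ → ℕ → ℚ
  ψ X m = inv2^ (sumFin b + s) ℚ.* ι (2 ^ m) ℚ.* tail2^ (cutoff m) X

  ψ-nonNeg : ∀ X m → 0ℚ ℚ.≤ ψ X m
  ψ-nonNeg X m = *-nonNeg (*-nonNeg (inv2^-nonNeg (sumFin b + s)) (ι-nonNeg (2 ^ m))) (tail2^-nonNeg (cutoff m) X)

  module _ {u : Fin s → Bool} {z : Fin s → ℕ} (box : InBox u z) (inAℓu : inA ℓ u ≡ true) where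

    dyadicWalSum≡0 : ∀ m → ¬ cutoff m ≤ sumFin z → dyadicWalSum Cm (flipTop ℓ z) m ≡ 0
    dyadicWalSum≡0 m below with dyadicWalSum Cm (flipTop ℓ z) m in D
    ... | zero  = refl
    ... | suc _ = contradiction (m≤n+o⇒m∸n≤o (2 * m) (2 * sumFin b + t) weight) below
      where
      weight : 2 * m ≤ 2 * sumFin b + t + sumFin z
      weight = ≤-trans (dyadicWalSum>0⇒weight ν≡b z ts box inAℓu m (subst (0 <_) (sym D) (s≤s z≤n)))
                       (≤-reflexive (trans (+-assoc (sumFin z) _ t) (+-comm (sumFin z) _)))

    weighted-dyadicWalSum≤ψ : ∀ m → inv2^ (sumFin b + sumFin z + s) ℚ.* ι (dyadicWalSum Cm (flipTop ℓ z) m) ℚ.≤ ψ (sumFin z) m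
    weighted-dyadicWalSum≤ψ m with cutoff m ≤? sumFin z
    ... | yes _     = begin
      inv2^ (B + X + s) ℚ.* ι (dyadicWalSum Cm (flipTop ℓ z) m) ≤⟨ *-monoˡ-≤-nonNeg (inv2^-nonNeg (B + X + s)) (ι-mono-≤ (dyadicWalSum≤2^ Cm (flipTop ℓ z) m)) ⟩
      inv2^ (B + X + s) ℚ.* ι (2 ^ m)                          ≡⟨ cong (ℚ._* ι (2 ^ m)) (trans (cong inv2^ (xy∙z≈xz∙y B X s)) (inv2^-+ (B + s) X)) ⟩
      inv2^ (B + s) ℚ.* inv2^ X ℚ.* ι (2 ^ m)                  ≡⟨ solve 3 (λ a x p → a :* x :* p := a :* p :* x) refl (inv2^ (B + s)) (inv2^ X) (ι (2 ^ m)) ⟩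
      inv2^ (B + s) ℚ.* ι (2 ^ m) ℚ.* inv2^ X                  ∎
      where
      open ℚ.≤-Reasoning
      open ℚ-Solver.+-*-Solver
      open Algebra.Properties.CommutativeSemigroup +-commutativeSemigroup using (xy∙z≈xz∙y)
      B = sumFin b
      X = sumFin z
    ... | no  below = ℚ.≤-reflexive (begin
      inv2^ (sumFin b + sumFin z + s) ℚ.* ι (dyadicWalSum Cm (flipTop ℓ z) m) ≡⟨ cong (λ d → inv2^ (sumFin b + sumFin z + s) ℚ.* ι d) (dyadicWalSum≡0 m below) ⟩
      inv2^ (sumFin b + sumFin z + s) ℚ.* 0ℚ                                   ≡⟨ ℚ.*-zeroʳ (inv2^ (sumFin b + sumFin z + s)) ⟩
      0ℚ                                                                       ≡⟨ sym (ℚ.*-zeroʳ (inv2^ (sumFin b + s) ℚ.* ι (2 ^ m))) ⟩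
      inv2^ (sumFin b + s) ℚ.* ι (2 ^ m) ℚ.* 0ℚ                               ∎)
      where open ≡-Reasoning

    ∣term∣≤ : ∀ {n ms} → Linked _>_ ms → suc n ≡ sum (map (2 ^_) ms) →
      ∣ inv2^ (sumFin (μ₁ ∘ ℓ) + sumFin z + s) ℚ.* walAvg Cm (suc n) (flipTop ℓ z) ∣ ℚ.≤ (pos 1 ℚ./ suc n) ℚ.* Σℚ ms (ψ (sumFin z))
    ∣term∣≤ {n} {ms} sorted N≡ = begin
      ∣ inv2^ (sumFin (μ₁ ∘ ℓ) + sumFin z + s) ℚ.* walAvg Cm (suc n) k ∣
        ≡⟨ ℚ.∣p*q∣≡∣p∣*∣q∣ (inv2^ (sumFin (μ₁ ∘ ℓ) + sumFin z + s)) (walAvg Cm (suc n) k) ⟩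
      ∣ inv2^ (sumFin (μ₁ ∘ ℓ) + sumFin z + s) ∣ ℚ.* ∣ walAvg Cm (suc n) k ∣
        ≡⟨ cong₂ ℚ._*_ ∣weight∣≡a (∣z/N∣ (walSum Cm k (upTo (suc n))) n) ⟩
      a ℚ.* (ι ∣ walSum Cm k (upTo (suc n)) ∣ℤ ℚ.* 1/N)
        ≤⟨ *-monoˡ-≤-nonNeg (inv2^-nonNeg (sumFin b + sumFin z + s)) (*-monoʳ-≤-nonNeg (1/N-nonNeg n) (ι-mono-≤ ∣walSum∣≤Σ)) ⟩
      a ℚ.* (ι (sum (map (dyadicWalSum Cm k) ms)) ℚ.* 1/N)
        ≡⟨ cong (λ x → a ℚ.* (x ℚ.* 1/N)) (ι-sum (dyadicWalSum Cm k) ms) ⟩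
      a ℚ.* (Σℚ ms (ι ∘ dyadicWalSum Cm k) ℚ.* 1/N)
        ≡⟨ solve 3 (λ a x r → a :* (x :* r) := r :* (a :* x)) refl a (Σℚ ms (ι ∘ dyadicWalSum Cm k)) 1/N ⟩
      1/N ℚ.* (a ℚ.* Σℚ ms (ι ∘ dyadicWalSum Cm k))
        ≡⟨ cong (1/N ℚ.*_) (sym (Σℚ-*ˡ a (ι ∘ dyadicWalSum Cm k) ms)) ⟩
      1/N ℚ.* Σℚ ms (λ m → a ℚ.* ι (dyadicWalSum Cm k m))
        ≤⟨ *-monoˡ-≤-nonNeg (1/N-nonNeg n) (Σℚ-mono ms weighted-dyadicWalSum≤ψ) ⟩
      1/N ℚ.* Σℚ ms (ψ (sumFin z)) ∎
      where
      open ℚ.≤-Reasoning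
      open ℚ-Solver.+-*-Solver
      k = flipTop ℓ z
      a = inv2^ (sumFin b + sumFin z + s)
      1/N = pos 1 ℚ./ suc n
      ∣weight∣≡a : ∣ inv2^ (sumFin (μ₁ ∘ ℓ) + sumFin z + s) ∣ ≡ a
      ∣weight∣≡a = trans (ℚ.0≤p⇒∣p∣≡p (inv2^-nonNeg (sumFin (μ₁ ∘ ℓ) + sumFin z + s)))
                         (cong (λ B → inv2^ (B + sumFin z + s)) (cong sum (List.map-cong ν≡b (allFin s))))
      ∣walSum∣≤Σ : ∣ walSum Cm k (upTo (suc n)) ∣ℤ ≤ sum (map (dyadicWalSum Cm k) ms)
      ∣walSum∣≤Σ = subst (λ N → ∣ walSum Cm k (upTo N) ∣ℤ ≤ sum (map (dyadicWalSum Cm k) ms)) (sym N≡) (∣walSum∣≤ Cm k ms sorted)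

  module _ {n ms} (sorted : Linked _>_ ms) (N≡ : suc n ≡ sum (map (2 ^_) ms)) (Z : ℕ) where

    private
      1/N = pos 1 ℚ./ suc n

      Φ : (Fin s → ℕ) → ℚ
      Φ z = 1/N ℚ.* Σℚ ms (ψ (sumFin z))

      summand : (Fin s → Bool) → ℚ
      summand u = if inA ℓ u
        then sign (s ∸ card u) ℚ.* Σℚ (box s u Z) (λ z → inv2^ (sumFin (μ₁ ∘ ℓ) + sumFin z + s) ℚ.* walAvg Cm (suc n) (flipTop ℓ z))
        else 0ℚ

    ∣summand∣≤ : ∀ u → ∣ summand u ∣ ℚ.≤ Σℚ (box s u Z) Φ
    ∣summand∣≤ u with inA ℓ u in inAℓu
    ... | false = Σℚ-nonNeg (box s u Z) λ z → *-nonNeg (1/N-nonNeg n) (Σℚ-nonNeg ms (ψ-nonNeg (sumFin z)))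
    ... | true  = begin
      ∣ sign (s ∸ card u) ℚ.* Σℚ (box s u Z) term ∣    ≡⟨ ℚ.∣p*q∣≡∣p∣*∣q∣ (sign (s ∸ card u)) _ ⟩
      ∣ sign (s ∸ card u) ∣ ℚ.* ∣ Σℚ (box s u Z) term ∣ ≡⟨ trans (cong (ℚ._* ∣ Σℚ (box s u Z) term ∣) (∣sign∣ (s ∸ card u))) (ℚ.*-identityˡ _) ⟩
      ∣ Σℚ (box s u Z) term ∣                            ≤⟨ ∣Σℚ∣≤Σℚ∣∣ term (box s u Z) ⟩
      Σℚ (box s u Z) (λ z → ∣ term z ∣)                  ≤⟨ Σℚ-mono-All (All.map (λ box → ∣term∣≤ box inAℓu sorted N≡) (all-InBox s u Z)) ⟩
      Σℚ (box s u Z) Φ                                   ∎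
      where
      open ℚ.≤-Reasoning
      term : (Fin s → ℕ) → ℚ
      term z = inv2^ (sumFin (μ₁ ∘ ℓ) + sumFin z + s) ℚ.* walAvg Cm (suc n) (flipTop ℓ z)

    ∣cTrunc∣≤ : ∣ cTrunc Cm (suc n) ℓ Z ∣ ℚ.≤ 1/N ℚ.* Σℚ ms (λ m → Σℚ (allSubsets s) (λ u → Σℚ (box s u Z) (λ z → ψ (sumFin z) m)))
    ∣cTrunc∣≤ = begin
      ∣ Σℚ (allSubsets s) summand ∣                              ≤⟨ ∣Σℚ∣≤Σℚ∣∣ summand (allSubsets s) ⟩
      Σℚ (allSubsets s) (λ u → ∣ summand u ∣)                     ≤⟨ Σℚ-mono (allSubsets s) ∣summand∣≤ ⟩
      Σℚ (allSubsets s) (λ u → Σℚ (box s u Z) Φ)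
        ≡⟨ Σℚ-cong (allSubsets s) (λ u → trans (Σℚ-*ˡ 1/N _ (box s u Z)) (cong (1/N ℚ.*_) (Σℚ-comm (λ z m → ψ (sumFin z) m) (box s u Z) ms))) ⟩
      Σℚ (allSubsets s) (λ u → 1/N ℚ.* Σℚ ms (λ m → Σℚ (box s u Z) (λ z → ψ (sumFin z) m)))
                                                                  ≡⟨ Σℚ-*ˡ 1/N _ (allSubsets s) ⟩
      1/N ℚ.* Σℚ (allSubsets s) (λ u → Σℚ ms (λ m → Σℚ (box s u Z) (λ z → ψ (sumFin z) m)))
                                                                  ≡⟨ cong (1/N ℚ.*_) (Σℚ-comm (λ u m → Σℚ (box s u Z) (λ z → ψ (sumFin z) m)) (allSubsets s) ms) ⟩
      1/N ℚ.* Σℚ ms (λ m → Σℚ (allSubsets s) (λ u → Σℚ (box s u Z) (λ z → ψ (sumFin z) m))) ∎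
      where open ℚ.≤-Reasoning

  Σψ≤ : ∀ Z m → Σℚ (allSubsets s) (λ u → Σℚ (box s u Z) (λ z → ψ (sumFin z) m))
                 ℚ.≤ inv2^ (sumFin b) ℚ.* ι (2 ^ m) ℚ.* inv2^ (cutoff m) ℚ.* ι (boxTail s (cutoff m))
  Σψ≤ Z m = begin
    Σℚ (allSubsets s) (λ u → Σℚ (box s u Z) (λ z → ψ (sumFin z) m))
      ≡⟨ trans (Σℚ-cong (allSubsets s) (λ u → Σℚ-*ˡ K (tail2^ M ∘ sumFin) (box s u Z))) (Σℚ-*ˡ K _ (allSubsets s)) ⟩
    K ℚ.* Σℚ (allSubsets s) (λ u → Σℚ (box s u Z) (tail2^ M ∘ sumFin))
      ≤⟨ *-monoˡ-≤-nonNeg (*-nonNeg (inv2^-nonNeg (B + s)) (ι-nonNeg (2 ^ m))) (Σℚ-mono (allSubsets s) (λ u → Σbox-tail2^≤ s u Z M)) ⟩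
    K ℚ.* Σℚ (allSubsets s) (λ _ → inv2^ M ℚ.* ι (boxTail s M))
      ≡⟨ cong (K ℚ.*_) (trans (Σℚ-const _ (allSubsets s)) (cong (λ l → ι l ℚ.* (inv2^ M ℚ.* ι (boxTail s M))) (length-allSubsets s))) ⟩
    inv2^ (B + s) ℚ.* ι (2 ^ m) ℚ.* (ι (2 ^ s) ℚ.* (inv2^ M ℚ.* ι (boxTail s M)))
      ≡⟨ cong (λ x → x ℚ.* ι (2 ^ m) ℚ.* (ι (2 ^ s) ℚ.* (inv2^ M ℚ.* ι (boxTail s M)))) (inv2^-+ B s) ⟩
    inv2^ B ℚ.* inv2^ s ℚ.* ι (2 ^ m) ℚ.* (ι (2 ^ s) ℚ.* (inv2^ M ℚ.* ι (boxTail s M)))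
      ≡⟨ solve 6 (λ b i p j x q → b :* i :* p :* (j :* (x :* q)) := b :* p :* x :* q :* (i :* j)) refl
           (inv2^ B) (inv2^ s) (ι (2 ^ m)) (ι (2 ^ s)) (inv2^ M) (ι (boxTail s M)) ⟩
    inv2^ B ℚ.* ι (2 ^ m) ℚ.* inv2^ M ℚ.* ι (boxTail s M) ℚ.* (inv2^ s ℚ.* ι (2 ^ s))
      ≡⟨ trans (cong (inv2^ B ℚ.* ι (2 ^ m) ℚ.* inv2^ M ℚ.* ι (boxTail s M) ℚ.*_) (inv2^*2^≡1 s)) (ℚ.*-identityʳ _) ⟩
    inv2^ B ℚ.* ι (2 ^ m) ℚ.* inv2^ M ℚ.* ι (boxTail s M) ∎
    where
    open ℚ.≤-Reasoning
    open ℚ-Solver.+-*-Solver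
    B = sumFin b
    M = cutoff m
    K = inv2^ (B + s) ℚ.* ι (2 ^ m)

cutoff≤2*[m∸B] : ∀ t B m → 2 * m ∸ (2 * B + t) ≤ 2 * (m ∸ B)
cutoff≤2*[m∸B] t B m = ≤-trans (∸-monoʳ-≤ (2 * m) (m≤m+n (2 * B) t)) (≤-reflexive (sym (*-distribˡ-∸ 2 m B)))

dyadicTerm≤ : ∀ s t B m →
  inv2^ B ℚ.* ι (2 ^ m) ℚ.* inv2^ (2 * m ∸ (2 * B + t)) ℚ.* ι (boxTail (suc s) (2 * m ∸ (2 * B + t)))
  ℚ.≤ (ι (2 ^ t) ℚ.* ι (2 ^ suc s)) ℚ.* (pow2ℤ (pos m ℤ.- pos B ℤ.- pos 2 ℤ.* pos (m ∸ B)) ℚ.* ι ((2 * (m ∸ B) + suc s ∸ 1) C (suc s ∸ 1)))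
dyadicTerm≤ s t B m = begin
  factor ℚ.* ι (boxTail (suc s) M)             ≤⟨ *-monoʳ-≤-nonNeg (ι-nonNeg (boxTail (suc s) M)) (dyadicFactor≤ t B m) ⟩
  ι (2 ^ t) ℚ.* pw ℚ.* ι (boxTail (suc s) M)
    ≤⟨ *-monoˡ-≤-nonNeg (ℚ.≤-trans factor-nonNeg (dyadicFactor≤ t B m)) (ℚ.≤-trans (ι-mono-≤ boxTail≤) (ℚ.≤-reflexive (ι-* (2 ^ suc s) binom))) ⟩
  ι (2 ^ t) ℚ.* pw ℚ.* (ι (2 ^ suc s) ℚ.* ι binom) ≡⟨ solve 4 (λ a b c d → a :* b :* (c :* d) := a :* c :* (b :* d)) refl (ι (2 ^ t)) pw (ι (2 ^ suc s)) (ι binom) ⟩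
  ι (2 ^ t) ℚ.* ι (2 ^ suc s) ℚ.* (pw ℚ.* ι binom) ∎
  where
  open ℚ.≤-Reasoning
  open ℚ-Solver.+-*-Solver
  M = 2 * m ∸ (2 * B + t)
  factor = inv2^ B ℚ.* ι (2 ^ m) ℚ.* inv2^ M
  factor-nonNeg : 0ℚ ℚ.≤ factor
  factor-nonNeg = *-nonNeg (*-nonNeg (inv2^-nonNeg B) (ι-nonNeg (2 ^ m))) (inv2^-nonNeg M)
  pw = pow2ℤ (pos m ℤ.- pos B ℤ.- pos 2 ℤ.* pos (m ∸ B))
  binom = (2 * (m ∸ B) + suc s ∸ 1) C (suc s ∸ 1)
  boxTail≤ : boxTail (suc s) M ≤ 2 ^ suc s * binom
  boxTail≤ = ≤-trans (boxTail≤binomial s M) (*-monoʳ-≤ (2 ^ suc s)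
    (≤-trans (C-monoˡ-≤ s (+-monoˡ-≤ s (cutoff≤2*[m∸B] t B m))) (≤-reflexive (cong (λ x → (x ∸ 1) C s) (sym (+-suc (2 * (m ∸ B)) s))))))

∣cTrunc∣≤C*boundSum : ∀ {s t} {Cm : GenMatrices (suc s)} → IsOrder2DigitalTS t (suc s) Cm →
  ∀ {n ms} → Linked _>_ ms → suc n ≡ sum (map (2 ^_) ms) → ∀ {b ℓ} → (∀ j → μ₁ (ℓ j) ≡ b j) → ∀ Z →
  ∣ cTrunc Cm (suc n) ℓ Z ∣ ℚ.≤ (ι (2 ^ t) ℚ.* ι (2 ^ suc s)) ℚ.* boundSum (suc s) (suc n) b ms
∣cTrunc∣≤C*boundSum {s} {t} {Cm} ts {n} {ms} sorted N≡ {b} {ℓ} ν≡b Z = begin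
  ∣ cTrunc Cm (suc n) ℓ Z ∣                                    ≤⟨ ∣cTrunc∣≤ ts ν≡b sorted N≡ Z ⟩
  1/N ℚ.* Σℚ ms (λ m → Σℚ (allSubsets (suc s)) (λ u → Σℚ (box (suc s) u Z) (λ z → ψ ts ν≡b (sumFin z) m)))
    ≤⟨ *-monoˡ-≤-nonNeg (1/N-nonNeg n) (Σℚ-mono ms (λ m → ℚ.≤-trans (Σψ≤ ts ν≡b Z m) (dyadicTerm≤ s t (sumFin b) m))) ⟩
  1/N ℚ.* Σℚ ms (λ m → K ℚ.* β m)                             ≡⟨ cong (1/N ℚ.*_) (Σℚ-*ˡ K β ms) ⟩
  1/N ℚ.* (K ℚ.* Σℚ ms β)                                     ≡⟨ solve 3 (λ r c x → r :* (c :* x) := c :* (r :* x)) refl 1/N K (Σℚ ms β) ⟩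
  K ℚ.* (1/N ℚ.* Σℚ ms β)                                     ∎
  where
  open ℚ.≤-Reasoning
  open ℚ-Solver.+-*-Solver
  1/N = pos 1 ℚ./ suc n
  K = ι (2 ^ t) ℚ.* ι (2 ^ suc s)
  β : ℕ → ℚ
  β m = pow2ℤ (pos m ℤ.- pos (sumFin b) ℤ.- pos 2 ℤ.* pos (m ∸ sumFin b)) ℚ.* ι ((2 * (m ∸ sumFin b) + suc s ∸ 1) C (suc s ∸ 1))

lemma5 : (s t : ℕ) → 1 ≤ s →
    Σ ℚ λ C → (0ℚ ℚ.< C) ×
      ((Cm : GenMatrices s) → IsOrder2DigitalTS t s Cm →
       (N : ℕ) (ms : List ℕ) → 2 ≤ N → Linked _>_ ms → N ≡ sum (map (2 ^_) ms) →
       (b ℓ : Fin s → ℕ) → (∀ j → μ₁ (ℓ j) ≡ b j) →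
       (ε : ℚ) → 0ℚ ℚ.< ε →
       Σ ℕ λ Z₀ → (Z : ℕ) → Z₀ ≤ Z →
         ∣ cTrunc Cm N ℓ Z ∣ ℚ.≤ (C ℚ.* boundSum s N b ms) ℚ.+ ε)
-- The bound holds for every truncation Z.
lemma5 (suc s) t _ = K , K>0 , λ { Cm ts (suc n) ms _ sorted N≡ b ℓ ν≡b ε ε>0 → 0 , λ Z _ →
  ≤-+-nonNeg ε (ℚ.<⇒≤ ε>0) (∣cTrunc∣≤C*boundSum ts sorted N≡ ν≡b Z) }
  where
  K = ι (2 ^ t) ℚ.* ι (2 ^ suc s)
  K>0 : 0ℚ ℚ.< K
  K>0 = subst (0ℚ ℚ.<_) (ι-* (2 ^ t) (2 ^ suc s)) (ι-pos (subst (0 <_) (^-distribˡ-+-* 2 t (suc s)) (m^n>0 2 (t + suc s))))
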